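{- Fix a logic $\mathcal{L}$. Let $\mathscr{E}$ be the class of morphisms $\epsilon$ in $\mathbf{FA}_{\mathcal{L}}$ such that $\epsilon^o$ is bijective on objects and full and every component of $\epsilon^p$ is surjective, and let $\mathscr{M}$ be the class of subprop-morphisms in $\mathbf{FA}_{\mathcal{L}}$. Then $(\mathscr{E},\mathscr{M})$ is an (orthogonal) factorization system on the underlying 1-category of $\mathbf{FA}_{\mathcal{L}}$.
   Context: Syntax and logics: a first-order language $\mathscr{L}$ has quantifier symbols $\mathscr{L}_q$ and connectives $\mathscr{L}_\omega$ with arities (designated $e\in\mathscr{L}_0$, $\otimes\in\mathscr{L}_2$); signatures; terms- and formulas-in-context; assertions (equations-in-context and sequents-in-context); theories are sets of assertions. A logic $\mathcal{L}$ assigns to each signature a closure operator $T\mapsto T_{\mathcal{L}}$ on theories (satisfying typed equational logic); $T\vdash_{\mathcal{L}}T'$ iff $A(T')\subseteq A(T_{\mathcal{L}})$. $\mathrm{Ob}(\mathbf{FA})$: prop-categories $(\mathcal{C},P)$ ($\mathcal{C}$ with designated finite products, $P:\mathcal{C}^{op}\to\mathbf{Pos}$) with $\mathscr{L}_\omega$-algebra structures on each $P(c)$ preserved by $P(f)$, elements $Eq_c\in P(c\times c)$, maps $\Omega_{b,c}:P(b\times c)\to P(b)$ natural in $b$, such that $(P(c),\otimes,e_c)$ is a monoid, $\Omega_{b,1}\circ P(\pi_1^{b,1})=\mathrm{id}$, $\Omega_{b,c\times d}\circ P(a_{b,c,d})=\Omega_{b,c}\circ\Omega_{b\times c,d}$,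 $Eq_1=e_{1\times1}$, $Eq_{c_1\times c_2}=P(\langle\pi_1^{c_1,c_2}\pi_1,\pi_1^{c_1,c_2}\pi_2\rangle)(Eq_{c_1})\otimes P(\langle\pi_2^{c_1,c_2}\pi_1,\pi_2^{c_1,c_2}\pi_2\rangle)(Eq_{c_2})$. Structures interpret terms as morphisms and formulas as elements of $P$ in the standard way; satisfaction of a sequent means $\bigotimes[\![\phi_i]\!]\le[\![\phi]\!]$, of an equation equality of interpretations; $T\models_{(\mathcal{C},P)}T'$ iff every $T$-model in $(\mathcal{C},P)$ satisfies $T'$. $\mathbf{FA}_{\mathcal{L}}$ is the full sub-2-category of $\mathbf{FA}$ on those $(\mathcal{C},P)$ with $T\vdash_{\mathcal{L}}T'\Rightarrow T\models_{(\mathcal{C},P)}T'$. Morphisms $F:(\mathcal{C},P)\to(\mathcal{D},Q)$: finite-product-preserving $F^o$ and natural $F^p:P\Rightarrow QF^o$ with each $F^p_c$ an $\mathscr{L}_\omega$-homomorphism, $F^p_b\Omega_{b,c}=\Omega_{F^ob,F^oc}Q(a_{F,b,c}^{ -1})F^p_{b\times c}$, $F^p_{c\times c}(Eq_c)=Q(a_{F,c,c})Eq_{F^oc}$; composition $(K\circ F)^o=K^oF^o$, $(K\circ F)^p_c=K^p_{F^oc}F^p_c$. A subprop-morphism is a morphism $\iota$ with $\iota^o$ faithful and each $\iota^p$-component an order embedding. An orthogonal factorization system $(\mathscr{E},\mathscr{M})$: both classes contain all isomorphisms and are closed under composition, every morphism factors as $m\circ e$ with $e\in\mathscr{E}$,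 $m\in\mathscr{M}$, and for every commutative square $v\circ m\circ e=m'\circ e'\circ u$ with $e\in\mathscr{E}$, $m'\in\mathscr{M}$ (more generally $m'\circ g=v\circ f$ with $f\in\mathscr{E}$... i.e. whenever $v\circ h=m'\circ k$ with $h\in\mathscr{E}$, $m'\in\mathscr{M}$) there is a unique diagonal $w$ with $w\circ h=k$ and $m'\circ w=v$. -}

module Defs where

open import Level using (Level; _⊔_; 0ℓ) renaming (suc to lsuc)
open import Data.Nat using (ℕ)
open import Data.Vec using (Vec; []; _∷_)
import Data.Vec as Vec
open import Data.Vec.Relation.Binary.Pointwise.Inductive using (Pointwise)
open import Data.List using (List; []; _∷_)
open import Data.Product using (Σ; Σ-syntax; _×_; _,_; proj₁; proj₂; ∃)
open import Relation.Binary.PropositionalEquality using (_≡_; subst; subst₂)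
open import Relation.Binary.Structures using (IsEquivalence)
open import Relation.Binary.Bundles using (Poset)
open import Relation.Unary using (Pred; _⊆_)

record Language : Set₁ where
  field
    Quant : Set
    Conn  : ℕ → Set
    e⁰    : Conn 0
    ⊗²    : Conn 2

data Ctx (S : Set) : Set where
  ε   : Ctx S
  _▸_ : Ctx S → S → Ctx S

record Signature : Set₁ where
  field
    Sort : Set
    Fun  : Set
    dom  : Fun → Ctx Sort
    cod  : Fun → Sort
    Rel  : Set
    ar   : Rel → Ctx Sort

module Syntax (𝓛 : Language) (Sg : Signature) where
  open Language 𝓛
  open Signature Sg

  data _∋_ : Ctx Sort → Sort → Set where
    here  : ∀ {Γ s} → (Γ ▸ s) ∋ s
    there : ∀ {Γ s t} → Γ ∋ s → (Γ ▸ t) ∋ s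

  data Term (Γ : Ctx Sort) : Sort → Set
  data Terms (Γ : Ctx Sort) : Ctx Sort → Set

  data Term Γ where
    var : ∀ {s} → Γ ∋ s → Term Γ s
    app : (f : Fun) → Terms Γ (dom f) → Term Γ (cod f)

  data Terms Γ where
    []ₜ  : Terms Γ ε
    _,ₜ_ : ∀ {Δ s} → Terms Γ Δ → Term Γ s → Terms Γ (Δ ▸ s)

  data Formula : Ctx Sort → Set where
    rel   : ∀ {Γ} (R : Rel) → Terms Γ (ar R) → Formula Γ
    eq    : ∀ {Γ s} → Term Γ s → Term Γ s → Formula Γ
    conn  : ∀ {Γ n} → Conn n → Vec (Formula Γ) n → Formula Γ
    quant : ∀ {Γ} → Quant → (s : Sort) → Formula (Γ ▸ s) → Formula Γ

  data Assertion : Set where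
    equation : (Γ : Ctx Sort) (s : Sort) → Term Γ s → Term Γ s → Assertion
    sequent  : (Γ : Ctx Sort) → List (Formula Γ) → Formula Γ → Assertion

  Theory : Set₁
  Theory = Pred Assertion 0ℓ

  Sub : Ctx Sort → Ctx Sort → Set
  Sub Δ Γ = ∀ {s} → Γ ∋ s → Term Δ s

  _[_]  : ∀ {Γ Δ s} → Term Γ s → Sub Δ Γ → Term Δ s
  _[_]* : ∀ {Γ Δ Θ} → Terms Γ Θ → Sub Δ Γ → Terms Δ Θ
  var x [ σ ] = σ x
  app f ts [ σ ] = app f (ts [ σ ]*)
  []ₜ [ σ ]* = []ₜ
  (ts ,ₜ t) [ σ ]* = (ts [ σ ]*) ,ₜ (t [ σ ])

  EqArgs : Theory → ∀ {Γ Δ} → Terms Γ Δ → Terms Γ Δ → Set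
  EqArgs T {Γ} []ₜ []ₜ = Data.Unit.⊤ where import Data.Unit
  EqArgs T {Γ} (_,ₜ_ {s = s} ts t) (us ,ₜ u) = EqArgs T ts us × T (equation Γ s t u)

  record EqClosed (T : Theory) : Set where
    field
      eq-refl  : ∀ Γ s (t : Term Γ s) → T (equation Γ s t t)
      eq-sym   : ∀ Γ s (t u : Term Γ s) → T (equation Γ s t u) → T (equation Γ s u t)
      eq-trans : ∀ Γ s (t u v : Term Γ s) → T (equation Γ s t u) → T (equation Γ s u v)
                 → T (equation Γ s t v)
      eq-cong  : ∀ Γ (f : Fun) (ts us : Terms Γ (dom f)) → EqArgs T ts us
                 → T (equation Γ (cod f) (app f ts) (app f us))
      eq-subst : ∀ Γ Δ s (t u : Term Γ s) (σ : Sub Δ Γ) → T (equation Γ s t u)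
                 → T (equation Δ s (t [ σ ]) (u [ σ ]))

record Logic (𝓛 : Language) : Set₂ where
  open Syntax 𝓛
  field
    cl         : (Sg : Signature) → Theory Sg → Theory Sg
    extensive  : ∀ Sg (T : Theory Sg) → T ⊆ cl Sg T
    monotone   : ∀ Sg (T T′ : Theory Sg) → T ⊆ T′ → cl Sg T ⊆ cl Sg T′
    idempotent : ∀ Sg (T : Theory Sg) → cl Sg (cl Sg T) ⊆ cl Sg T
    equational : ∀ Sg (T : Theory Sg) → EqClosed Sg (cl Sg T)

_⊢⟨_⟩_ : ∀ {𝓛 Sg} → Syntax.Theory 𝓛 Sg → Logic 𝓛 → Syntax.Theory 𝓛 Sg → Set
_⊢⟨_⟩_ {Sg = Sg} T L T′ = T′ ⊆ Logic.cl L Sg T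

record Category (o h e : Level) : Set (lsuc (o ⊔ h ⊔ e)) where
  infixr 9 _∘_
  infix 4 _≈_
  field
    Obj : Set o
    Hom : Obj → Obj → Set h
    _≈_ : ∀ {a b} → Hom a b → Hom a b → Set e
    ≈-equiv : ∀ {a b} → IsEquivalence (_≈_ {a} {b})
    id  : ∀ {a} → Hom a a
    _∘_ : ∀ {a b c} → Hom b c → Hom a b → Hom a c
    ∘-resp-≈  : ∀ {a b c} {f f′ : Hom b c} {g g′ : Hom a b} → f ≈ f′ → g ≈ g′ → f ∘ g ≈ f′ ∘ g′
    identityˡ : ∀ {a b} {f : Hom a b} → id ∘ f ≈ f
    identityʳ : ∀ {a b} {f : Hom a b} → f ∘ id ≈ f
    assoc     : ∀ {a b c d} {f : Hom a b} {g : Hom b c} {k : Hom c d} → (k ∘ g) ∘ f ≈ k ∘ (g ∘ f)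

  IsIso : ∀ {a b} → Hom a b → Set (h ⊔ e)
  IsIso {a} {b} f = Σ[ g ∈ Hom b a ] (g ∘ f ≈ id × f ∘ g ≈ id)

record FinProducts {o h e} (C : Category o h e) : Set (o ⊔ h ⊔ e) where
  open Category C
  infixr 7 _×ₒ_
  field
    𝟙 : Obj
    ! : ∀ {a} → Hom a 𝟙
    !-unique : ∀ {a} (f : Hom a 𝟙) → f ≈ !
    _×ₒ_ : Obj → Obj → Obj
    π₁ : ∀ {a b} → Hom (a ×ₒ b) a
    π₂ : ∀ {a b} → Hom (a ×ₒ b) b
    ⟨_,_⟩ : ∀ {a b c} → Hom c a → Hom c b → Hom c (a ×ₒ b)
    π₁-β : ∀ {a b c} {f : Hom c a} {g : Hom c b} → π₁ ∘ ⟨ f , g ⟩ ≈ f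
    π₂-β : ∀ {a b c} {f : Hom c a} {g : Hom c b} → π₂ ∘ ⟨ f , g ⟩ ≈ g
    ⟨⟩-unique : ∀ {a b c} {f : Hom c a} {g : Hom c b} (k : Hom c (a ×ₒ b))
                → π₁ ∘ k ≈ f → π₂ ∘ k ≈ g → k ≈ ⟨ f , g ⟩

  _⁂_ : ∀ {a b c d} → Hom a c → Hom b d → Hom (a ×ₒ b) (c ×ₒ d)
  f ⁂ g = ⟨ f ∘ π₁ , g ∘ π₂ ⟩

  assocMap : ∀ b c d → Hom (b ×ₒ (c ×ₒ d)) ((b ×ₒ c) ×ₒ d)
  assocMap b c d = ⟨ ⟨ π₁ , π₁ ∘ π₂ ⟩ , π₂ ∘ π₂ ⟩

record PropCat (𝓛 : Language) (o h e p ℓ₁ ℓ₂ : Level)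
       : Set (lsuc (o ⊔ h ⊔ e ⊔ p ⊔ ℓ₁ ⊔ ℓ₂)) where
  open Language 𝓛
  field
    C    : Category o h e
    prod : FinProducts C
    P    : Category.Obj C → Poset p ℓ₁ ℓ₂
  open Category C
  open FinProducts prod

  infix 4 _≈ₚ_ _≤ₚ_
  infixr 6 _⊗_

  PC : Obj → Set p
  PC c = Poset.Carrier (P c)

  _≈ₚ_ : ∀ {c} → PC c → PC c → Set ℓ₁
  _≈ₚ_ {c} = Poset._≈_ (P c)

  _≤ₚ_ : ∀ {c} → PC c → PC c → Set ℓ₂
  _≤ₚ_ {c} = Poset._≤_ (P c)

  field
    Pmap      : ∀ {b c} → Hom b c → PC c → PC b
    Pmap-mono : ∀ {b c} (f : Hom b c) {x y : PC c} → x ≤ₚ y → Pmap f x ≤ₚ Pmap f y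
    Pmap-resp : ∀ {b c} {f g : Hom b c} (x : PC c) → f ≈ g → Pmap f x ≈ₚ Pmap g x
    Pmap-id   : ∀ {c} (x : PC c) → Pmap id x ≈ₚ x
    Pmap-∘    : ∀ {a b c} (g : Hom b c) (f : Hom a b) (x : PC c)
                → Pmap (g ∘ f) x ≈ₚ Pmap f (Pmap g x)
    ops      : ∀ {n} (c : Obj) → Conn n → Vec (PC c) n → PC c
    ops-cong : ∀ {n} (c : Obj) (ω : Conn n) {xs ys : Vec (PC c) n}
               → Pointwise _≈ₚ_ xs ys → ops c ω xs ≈ₚ ops c ω ys
    ops-nat  : ∀ {n b c} (f : Hom b c) (ω : Conn n) (xs : Vec (PC c) n)
               → Pmap f (ops c ω xs) ≈ₚ ops b ω (Vec.map (Pmap f) xs)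
    Eq     : ∀ c → PC (c ×ₒ c)
    Ω      : Quant → ∀ b c → PC (b ×ₒ c) → PC b
    Ω-cong : ∀ Q b c {x y : PC (b ×ₒ c)} → x ≈ₚ y → Ω Q b c x ≈ₚ Ω Q b c y
    Ω-nat  : ∀ Q {b′ b} c (f : Hom b′ b) (x : PC (b ×ₒ c))
             → Pmap f (Ω Q b c x) ≈ₚ Ω Q b′ c (Pmap (f ⁂ id) x)

  eₚ : ∀ c → PC c
  eₚ c = ops c e⁰ []

  _⊗_ : ∀ {c} → PC c → PC c → PC c
  _⊗_ {c} x y = ops c ⊗² (x ∷ y ∷ [])

  field
    ⊗-assoc : ∀ {c} (x y z : PC c) → (x ⊗ y) ⊗ z ≈ₚ x ⊗ (y ⊗ z)
    ⊗-unitˡ : ∀ {c} (x : PC c) → eₚ c ⊗ x ≈ₚ x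
    ⊗-unitʳ : ∀ {c} (x : PC c) → x ⊗ eₚ c ≈ₚ x
    Ω-unit  : ∀ Q b (x : PC b) → Ω Q b 𝟙 (Pmap (π₁ {b} {𝟙}) x) ≈ₚ x
    Ω-assoc : ∀ Q b c d (x : PC ((b ×ₒ c) ×ₒ d))
              → Ω Q b (c ×ₒ d) (Pmap (assocMap b c d) x) ≈ₚ Ω Q b c (Ω Q (b ×ₒ c) d x)
    Eq-𝟙    : Eq 𝟙 ≈ₚ eₚ (𝟙 ×ₒ 𝟙)
    Eq-×    : ∀ c₁ c₂ →
              Eq (c₁ ×ₒ c₂) ≈ₚ
                (Pmap ⟨ π₁ {c₁} {c₂} ∘ π₁ , π₁ {c₁} {c₂} ∘ π₂ ⟩ (Eq c₁)
                 ⊗ Pmap ⟨ π₂ {c₁} {c₂} ∘ π₁ , π₂ {c₁} {c₂} ∘ π₂ ⟩ (Eq c₂))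

module Semantics {𝓛 : Language} {o h e p ℓ₁ ℓ₂}
                 (X : PropCat 𝓛 o h e p ℓ₁ ℓ₂) (Sg : Signature) where
  open Language 𝓛
  open Signature Sg
  open PropCat X
  open Category C
  open FinProducts prod
  open Syntax 𝓛 Sg

  ctxObj : (Sort → Obj) → Ctx Sort → Obj
  ctxObj S ε = 𝟙
  ctxObj S (Γ ▸ s) = ctxObj S Γ ×ₒ S s

  record Structure : Set (o ⊔ h ⊔ p) where
    field
      sortI : Sort → Obj
      funI  : (f : Fun) → Hom (ctxObj sortI (dom f)) (sortI (cod f))
      relI  : (R : Rel) → PC (ctxObj sortI (ar R))

  module _ (M : Structure) where
    open Structure M

    ⟦_⟧ᶜ : Ctx Sort → Obj
    ⟦_⟧ᶜ = ctxObj sortI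

    ⟦_⟧ᵛ : ∀ {Γ s} → Γ ∋ s → Hom ⟦ Γ ⟧ᶜ (sortI s)
    ⟦ here ⟧ᵛ = π₂
    ⟦ there x ⟧ᵛ = ⟦ x ⟧ᵛ ∘ π₁

    ⟦_⟧ᵗ  : ∀ {Γ s} → Term Γ s → Hom ⟦ Γ ⟧ᶜ (sortI s)
    ⟦_⟧ᵗˢ : ∀ {Γ Δ} → Terms Γ Δ → Hom ⟦ Γ ⟧ᶜ ⟦ Δ ⟧ᶜ
    ⟦ var x ⟧ᵗ = ⟦ x ⟧ᵛ
    ⟦ app f ts ⟧ᵗ = funI f ∘ ⟦ ts ⟧ᵗˢ
    ⟦ []ₜ ⟧ᵗˢ = !
    ⟦ ts ,ₜ t ⟧ᵗˢ = ⟨ ⟦ ts ⟧ᵗˢ , ⟦ t ⟧ᵗ ⟩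

    ⟦_⟧ᶠ  : ∀ {Γ} → Formula Γ → PC ⟦ Γ ⟧ᶜ
    ⟦_⟧ᶠˢ : ∀ {Γ n} → Vec (Formula Γ) n → Vec (PC ⟦ Γ ⟧ᶜ) n
    ⟦ rel R ts ⟧ᶠ = Pmap ⟦ ts ⟧ᵗˢ (relI R)
    ⟦ eq {s = s} t u ⟧ᶠ = Pmap ⟨ ⟦ t ⟧ᵗ , ⟦ u ⟧ᵗ ⟩ (Eq (sortI s))
    ⟦ conn {Γ} ω φs ⟧ᶠ = ops ⟦ Γ ⟧ᶜ ω ⟦ φs ⟧ᶠˢ
    ⟦ quant {Γ} Q s φ ⟧ᶠ = Ω Q ⟦ Γ ⟧ᶜ (sortI s) ⟦ φ ⟧ᶠ
    ⟦ [] ⟧ᶠˢ = []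
    ⟦ φ ∷ φs ⟧ᶠˢ = ⟦ φ ⟧ᶠ ∷ ⟦ φs ⟧ᶠˢ

    ⨂ : ∀ {Γ} → List (Formula Γ) → PC ⟦ Γ ⟧ᶜ
    ⨂ {Γ} [] = eₚ ⟦ Γ ⟧ᶜ
    ⨂ (φ ∷ φs) = ⟦ φ ⟧ᶠ ⊗ ⨂ φs

    Sat : Assertion → Set (e ⊔ ℓ₂)
    Sat (equation Γ s t u) = Level.Lift (e ⊔ ℓ₂) (⟦ t ⟧ᵗ ≈ ⟦ u ⟧ᵗ)
    Sat (sequent Γ φs φ) = Level.Lift (e ⊔ ℓ₂) (⨂ φs ≤ₚ ⟦ φ ⟧ᶠ)

    IsModel : Theory → Set (e ⊔ ℓ₂)
    IsModel T = ∀ a → T a → Sat a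

  _⊨_ : Theory → Theory → Set (o ⊔ h ⊔ e ⊔ p ⊔ ℓ₂)
  T ⊨ T′ = ∀ (M : Structure) → IsModel M T → IsModel M T′

InFA : ∀ {𝓛 : Language} {o h e p ℓ₁ ℓ₂} → Logic 𝓛 → PropCat 𝓛 o h e p ℓ₁ ℓ₂
       → Set (lsuc 0ℓ ⊔ o ⊔ h ⊔ e ⊔ p ⊔ ℓ₂)
InFA {𝓛} L X = ∀ (Sg : Signature) (T T′ : Syntax.Theory 𝓛 Sg)
               → T ⊢⟨ L ⟩ T′ → Semantics._⊨_ X Sg T T′

module _ {𝓛 : Language} {o h e p ℓ₁ ℓ₂ : Level} where
  open Language 𝓛

  record PCMor (X Y : PropCat 𝓛 o h e p ℓ₁ ℓ₂) : Set (o ⊔ h ⊔ e ⊔ p ⊔ ℓ₁ ⊔ ℓ₂) where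
    private
      module X = PropCat X
      module Y = PropCat Y
      module CX = Category X.C
      module CY = Category Y.C
      module PX = FinProducts X.prod
      module PY = FinProducts Y.prod
    field
      F₀     : CX.Obj → CY.Obj
      F₁     : ∀ {a b} → CX.Hom a b → CY.Hom (F₀ a) (F₀ b)
      F₁-resp : ∀ {a b} {f g : CX.Hom a b} → f CX.≈ g → F₁ f CY.≈ F₁ g
      F₁-id  : ∀ {a} → F₁ (CX.id {a}) CY.≈ CY.id
      F₁-∘   : ∀ {a b c} (g : CX.Hom b c) (f : CX.Hom a b) → F₁ (g CX.∘ f) CY.≈ F₁ g CY.∘ F₁ f

    aF : ∀ b c → CY.Hom (F₀ (b PX.×ₒ c)) (F₀ b PY.×ₒ F₀ c)
    aF b c = PY.⟨ F₁ PX.π₁ , F₁ PX.π₂ ⟩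

    field
      pres-𝟙 : CY.IsIso (PY.! {F₀ PX.𝟙})
      pres-× : ∀ b c → CY.IsIso (aF b c)

    aF⁻¹ : ∀ b c → CY.Hom (F₀ b PY.×ₒ F₀ c) (F₀ (b PX.×ₒ c))
    aF⁻¹ b c = proj₁ (pres-× b c)

    field
      Fp      : ∀ c → X.PC c → Y.PC (F₀ c)
      Fp-mono : ∀ c {x y : X.PC c} → x X.≤ₚ y → Fp c x Y.≤ₚ Fp c y
      Fp-nat  : ∀ {b c} (f : CX.Hom b c) (x : X.PC c)
                → Y.Pmap (F₁ f) (Fp c x) Y.≈ₚ Fp b (X.Pmap f x)
      Fp-ops  : ∀ {n} c (ω : Conn n) (xs : Vec (X.PC c) n)
                → Fp c (X.ops c ω xs) Y.≈ₚ Y.ops (F₀ c) ω (Vec.map (Fp c) xs)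
      Fp-Ω    : ∀ Q b c (x : X.PC (b PX.×ₒ c))
                → Fp b (X.Ω Q b c x) Y.≈ₚ
                  Y.Ω Q (F₀ b) (F₀ c) (Y.Pmap (aF⁻¹ b c) (Fp (b PX.×ₒ c) x))
      Fp-Eq   : ∀ c → Fp (c PX.×ₒ c) (X.Eq c) Y.≈ₚ Y.Pmap (aF c c) (Y.Eq (F₀ c))

  -- raw data of a morphism (used to express equality and composition of 1-cells)
  record RawMor (X Y : PropCat 𝓛 o h e p ℓ₁ ℓ₂) : Set (o ⊔ h ⊔ p) where
    private
      module X = PropCat X
      module Y = PropCat Y
    field
      r₀ : Category.Obj X.C → Category.Obj Y.C
      r₁ : ∀ {a b} → Category.Hom X.C a b → Category.Hom Y.C (r₀ a) (r₀ b)
      rp : ∀ c → X.PC c → Y.PC (r₀ c)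

  raw : ∀ {X Y} → PCMor X Y → RawMor X Y
  raw F = record { r₀ = PCMor.F₀ F ; r₁ = PCMor.F₁ F ; rp = PCMor.Fp F }

  idʳ : ∀ {X} → RawMor X X
  idʳ = record { r₀ = λ c → c ; r₁ = λ f → f ; rp = λ c x → x }

  _∘ʳ_ : ∀ {X Y Z} → RawMor Y Z → RawMor X Y → RawMor X Z
  G ∘ʳ F = record
    { r₀ = λ c → RawMor.r₀ G (RawMor.r₀ F c)
    ; r₁ = λ f → RawMor.r₁ G (RawMor.r₁ F f)
    ; rp = λ c x → RawMor.rp G (RawMor.r₀ F c) (RawMor.rp F c x) }

  record _≈ʳ_ {X Y} (F G : RawMor X Y) : Set (o ⊔ h ⊔ e ⊔ p ⊔ ℓ₁) where
    private
      module X = PropCat X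
      module Y = PropCat Y
      module F = RawMor F
      module G = RawMor G
    field
      obj : ∀ c → F.r₀ c ≡ G.r₀ c
      hom : ∀ {a b} (f : Category.Hom X.C a b)
            → Category._≈_ Y.C (subst₂ (Category.Hom Y.C) (obj a) (obj b) (F.r₁ f)) (G.r₁ f)
      prp : ∀ c (x : X.PC c) → subst Y.PC (obj c) (F.rp c x) Y.≈ₚ G.rp c x

  IsE : ∀ {X Y} → PCMor X Y → Set (o ⊔ h ⊔ e ⊔ p ⊔ ℓ₁)
  IsE {X} {Y} F =
      (∀ {a b} → F₀ a ≡ F₀ b → a ≡ b)
    × (∀ (d : Category.Obj CY) → ∃ λ c → F₀ c ≡ d)
    × (∀ {a b} (g : Category.Hom CY (F₀ a) (F₀ b)) → ∃ λ f → Category._≈_ CY (F₁ f) g)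
    × (∀ c (y : PropCat.PC Y (F₀ c)) → ∃ λ x → PropCat._≈ₚ_ Y (Fp c x) y)
    where open PCMor F
          CY = PropCat.C Y

  IsM : ∀ {X Y} → PCMor X Y → Set (o ⊔ h ⊔ e ⊔ p ⊔ ℓ₂)
  IsM {X} {Y} F =
      (∀ {a b} (f g : Category.Hom (PropCat.C X) a b)
         → Category._≈_ (PropCat.C Y) (F₁ f) (F₁ g) → Category._≈_ (PropCat.C X) f g)
      -- each F^p_c an order embedding (it is monotone by definition)
    × (∀ c (x y : PropCat.PC X c) → PropCat._≤ₚ_ Y (Fp c x) (Fp c y) → PropCat._≤ₚ_ X x y)
    where open PCMor F

FAObj : ∀ (𝓛 : Language) (L : Logic 𝓛) (o h e p ℓ₁ ℓ₂ : Level) → Set _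
FAObj 𝓛 L o h e p ℓ₁ ℓ₂ = Σ (PropCat 𝓛 o h e p ℓ₁ ℓ₂) (InFA L)

record IsFactorizationSystem (𝓛 : Language) (L : Logic 𝓛) (o h e p ℓ₁ ℓ₂ : Level)
       {c₁ c₂ : Level}
       (𝓔 : ∀ (X Y : FAObj 𝓛 L o h e p ℓ₁ ℓ₂) → PCMor (proj₁ X) (proj₁ Y) → Set c₁)
       (𝓜 : ∀ (X Y : FAObj 𝓛 L o h e p ℓ₁ ℓ₂) → PCMor (proj₁ X) (proj₁ Y) → Set c₂)
       : Set (lsuc (o ⊔ h ⊔ e ⊔ p ⊔ ℓ₁ ⊔ ℓ₂) ⊔ c₁ ⊔ c₂) where
  Ob = FAObj 𝓛 L o h e p ℓ₁ ℓ₂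
  Mor : Ob → Ob → Set (o ⊔ h ⊔ e ⊔ p ⊔ ℓ₁ ⊔ ℓ₂)
  Mor X Y = PCMor (proj₁ X) (proj₁ Y)

  IsIsoᴹ : ∀ X Y → Mor X Y → Set (o ⊔ h ⊔ e ⊔ p ⊔ ℓ₁ ⊔ ℓ₂)
  IsIsoᴹ X Y F = Σ[ G ∈ Mor Y X ] ((raw G ∘ʳ raw F) ≈ʳ idʳ × (raw F ∘ʳ raw G) ≈ʳ idʳ)

  field
    𝓔-iso  : ∀ {X Y} (F : Mor X Y) → IsIsoᴹ X Y F → 𝓔 X Y F
    𝓜-iso  : ∀ {X Y} (F : Mor X Y) → IsIsoᴹ X Y F → 𝓜 X Y F
    𝓔-comp : ∀ {X Y Z} (F : Mor X Y) (G : Mor Y Z) (H : Mor X Z)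
             → 𝓔 X Y F → 𝓔 Y Z G → raw H ≈ʳ (raw G ∘ʳ raw F) → 𝓔 X Z H
    𝓜-comp : ∀ {X Y Z} (F : Mor X Y) (G : Mor Y Z) (H : Mor X Z)
             → 𝓜 X Y F → 𝓜 Y Z G → raw H ≈ʳ (raw G ∘ʳ raw F) → 𝓜 X Z H
    factor : ∀ {X Z} (F : Mor X Z)
             → Σ[ Y ∈ Ob ] Σ[ ε ∈ Mor X Y ] Σ[ m ∈ Mor Y Z ]
                 (𝓔 X Y ε × 𝓜 Y Z m × raw F ≈ʳ (raw m ∘ʳ raw ε))
    diagonal : ∀ {A B C D} (k : Mor A B) (u : Mor A C) (m : Mor C D) (v : Mor B D)
               → 𝓔 A B k → 𝓜 C D m → (raw v ∘ʳ raw k) ≈ʳ (raw m ∘ʳ raw u)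
               → Σ[ w ∈ Mor B C ]
                   ( (raw w ∘ʳ raw k) ≈ʳ raw u
                   × (raw m ∘ʳ raw w) ≈ʳ raw v
                   × (∀ (w′ : Mor B C) → (raw w′ ∘ʳ raw k) ≈ʳ raw u
                        → (raw m ∘ʳ raw w′) ≈ʳ raw v → raw w′ ≈ʳ raw w))

module Submission where

open import Defs
open import Level using (Level; lift)
open import Data.Vec using (Vec; []; _∷_)
import Data.Vec as Vec
import Data.Vec.Properties as Vec
open import Data.Vec.Relation.Binary.Pointwise.Inductive using (Pointwise; []; _∷_)
open import Data.List using (List; []; _∷_)
open import Data.Product using (_,_; proj₁; proj₂; ∃)
open import Relation.Binary.PropositionalEquality
  using (_≡_; refl; sym; trans; cong; cong₂; subst; subst₂)
open import Relation.Binary.PropositionalEquality.Properties using (subst-subst)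
open import Relation.Binary.Bundles using (Setoid; Poset)
import Relation.Binary.Reasoning.Setoid as SetoidReasoning
open import Axiom.UniquenessOfIdentityProofs.WithK using (uip)

-- A morphism F : X → Z factors through its image Im F: the prop-category with the
-- objects, morphisms, predicates and connectives of X, but with morphisms identified and
-- predicates compared as their images under F.  The identity-on-data map X → Im F is in ℰ,
-- the map Im F → Z given by F is in ℳ, and Im F lies in FA_𝓛 because interpreting a
-- structure of Im F in Z (composing with the finite-product comparison isomorphisms of F)
-- preserves and reflects satisfaction.  For the diagonal of a square v ∘ k = m ∘ u with
-- k ∈ ℰ and m ∈ ℳ, one lifts along k (bijective on objects, full, surjective on predicates)
-- and pushes along u; the result is well defined because m is faithful and an order
-- embedding, so k-equal data have u-equal images.

module CategoryProperties {o h e : Level} (C : Category o h e) where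
  open Category C public

  homSetoid : Obj → Obj → Setoid h e
  homSetoid a b = record { Carrier = Hom a b ; _≈_ = _≈_ ; isEquivalence = ≈-equiv }

  module ≈ {a b : Obj} = Setoid (homSetoid a b)
  module HomReasoning {a b : Obj} = SetoidReasoning (homSetoid a b)

  infixr 4 _⟩∘⟨_ refl⟩∘⟨_
  infixl 5 _⟩∘⟨refl

  _⟩∘⟨_ : ∀ {a b c} {f f′ : Hom b c} {g g′ : Hom a b} → f ≈ f′ → g ≈ g′ → f ∘ g ≈ f′ ∘ g′
  _⟩∘⟨_ = ∘-resp-≈

  refl⟩∘⟨_ : ∀ {a b c} {f : Hom b c} {g g′ : Hom a b} → g ≈ g′ → f ∘ g ≈ f ∘ g′
  refl⟩∘⟨ q = ∘-resp-≈ ≈.refl q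

  _⟩∘⟨refl : ∀ {a b c} {f f′ : Hom b c} {g : Hom a b} → f ≈ f′ → f ∘ g ≈ f′ ∘ g
  q ⟩∘⟨refl = ∘-resp-≈ q ≈.refl

  sym-assoc : ∀ {a b c d} {f : Hom a b} {g : Hom b c} {k : Hom c d} → k ∘ (g ∘ f) ≈ (k ∘ g) ∘ f
  sym-assoc = ≈.sym assoc

  cancelInner : ∀ {a b c d} {f : Hom a b} {g : Hom b c} {k : Hom c b} {l : Hom b d}
    → k ∘ g ≈ id → (l ∘ k) ∘ (g ∘ f) ≈ l ∘ f
  cancelInner {f = f} {g} {k} {l} kg≈id = begin
    (l ∘ k) ∘ (g ∘ f)  ≈⟨ assoc ⟩
    l ∘ (k ∘ (g ∘ f))  ≈⟨ refl⟩∘⟨ sym-assoc ⟩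
    l ∘ ((k ∘ g) ∘ f)  ≈⟨ refl⟩∘⟨ (kg≈id ⟩∘⟨refl) ⟩
    l ∘ (id ∘ f)       ≈⟨ refl⟩∘⟨ identityˡ ⟩
    l ∘ f              ∎
    where open HomReasoning

  cancelʳ : ∀ {a b c} {f : Hom a b} {g : Hom b a} {l : Hom a c} → g ∘ f ≈ id → (l ∘ g) ∘ f ≈ l
  cancelʳ gf≈id = ≈.trans assoc (≈.trans (refl⟩∘⟨ gf≈id) identityʳ)

  cancelˡ : ∀ {a b c} {f : Hom a b} {g : Hom b a} {l : Hom c a} → g ∘ f ≈ id → g ∘ (f ∘ l) ≈ l
  cancelˡ gf≈id = ≈.trans sym-assoc (≈.trans (gf≈id ⟩∘⟨refl) identityˡ)

  coe : ∀ {a b} → a ≡ b → Hom a b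
  coe refl = id

  coe-∘ : ∀ {a b c} (p : a ≡ b) (q : b ≡ c) (r : a ≡ c) → coe q ∘ coe p ≈ coe r
  coe-∘ refl refl refl = identityˡ

  coe-irrelevant : ∀ {a b} (p q : a ≡ b) → coe p ≈ coe q
  coe-irrelevant p q = ≈.reflexive (cong coe (uip p q))

  subst₂-resp : ∀ {a a′ b b′} (p : a ≡ a′) (q : b ≡ b′) {g g′ : Hom a b}
    → g ≈ g′ → subst₂ Hom p q g ≈ subst₂ Hom p q g′
  subst₂-resp refl refl g≈g′ = g≈g′

  subst₂-cancel : ∀ {a a′ b b′} (p : a ≡ a′) (q : b ≡ b′) {g g′ : Hom a b}
    → subst₂ Hom p q g ≈ subst₂ Hom p q g′ → g ≈ g′
  subst₂-cancel refl refl g≈g′ = g≈g′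

  subst₂-subst₂ : ∀ {a b c a′ b′ c′} (p : a ≡ b) (q : b ≡ c) (p′ : a′ ≡ b′) (q′ : b′ ≡ c′)
    (g : Hom a a′) → subst₂ Hom q q′ (subst₂ Hom p p′ g) ≡ subst₂ Hom (trans p q) (trans p′ q′) g
  subst₂-subst₂ refl q refl q′ g = refl

  IsIso-∘ : ∀ {a b c} {f : Hom a b} {g : Hom b c} → IsIso f → IsIso g → IsIso (g ∘ f)
  IsIso-∘ (f⁻¹ , f⁻¹f , ff⁻¹) (g⁻¹ , g⁻¹g , gg⁻¹) =
    f⁻¹ ∘ g⁻¹ , ≈.trans (cancelInner g⁻¹g) f⁻¹f , ≈.trans (cancelInner ff⁻¹) gg⁻¹

  IsIso-resp : ∀ {a b} {f g : Hom a b} → f ≈ g → IsIso f → IsIso g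
  IsIso-resp f≈g (f⁻¹ , f⁻¹f , ff⁻¹) =
    f⁻¹ , ≈.trans (refl⟩∘⟨ ≈.sym f≈g) f⁻¹f , ≈.trans (≈.sym f≈g ⟩∘⟨refl) ff⁻¹

  IsIso-inverse : ∀ {a b} {f : Hom a b} (i : IsIso f) → IsIso (proj₁ i)
  IsIso-inverse {f = f} (_ , f⁻¹f , ff⁻¹) = f , ff⁻¹ , f⁻¹f

  IsIso-coe : ∀ {a b} (p : a ≡ b) → IsIso (coe p)
  IsIso-coe p = coe (sym p) , coe-∘ p (sym p) refl , coe-∘ (sym p) p refl

module ProductProperties {o h e : Level} {C : Category o h e} (prod : FinProducts C) where
  open CategoryProperties C
  open FinProducts prod public

  !-unique₂ : ∀ {a} (f g : Hom a 𝟙) → f ≈ g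
  !-unique₂ f g = ≈.trans (!-unique f) (≈.sym (!-unique g))

  ⟨⟩-cong : ∀ {a b c} {f f′ : Hom c a} {g g′ : Hom c b} → f ≈ f′ → g ≈ g′ → ⟨ f , g ⟩ ≈ ⟨ f′ , g′ ⟩
  ⟨⟩-cong f≈f′ g≈g′ = ⟨⟩-unique _ (≈.trans π₁-β f≈f′) (≈.trans π₂-β g≈g′)

  ⟨⟩∘ : ∀ {a b c d} {f : Hom c a} {g : Hom c b} {k : Hom d c} → ⟨ f , g ⟩ ∘ k ≈ ⟨ f ∘ k , g ∘ k ⟩
  ⟨⟩∘ = ⟨⟩-unique _ (≈.trans sym-assoc (π₁-β ⟩∘⟨refl)) (≈.trans sym-assoc (π₂-β ⟩∘⟨refl))

  ⟨π₁,π₂⟩≈id : ∀ {a b} → ⟨ π₁ {a} {b} , π₂ ⟩ ≈ id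
  ⟨π₁,π₂⟩≈id = ≈.sym (⟨⟩-unique id identityʳ identityʳ)

  ⁂-cong : ∀ {a b c d} {f f′ : Hom a c} {g g′ : Hom b d} → f ≈ f′ → g ≈ g′ → f ⁂ g ≈ f′ ⁂ g′
  ⁂-cong f≈f′ g≈g′ = ⟨⟩-cong (f≈f′ ⟩∘⟨refl) (g≈g′ ⟩∘⟨refl)

  ⁂∘⟨⟩ : ∀ {a b c d x} {f : Hom a c} {g : Hom b d} {h : Hom x a} {k : Hom x b}
    → (f ⁂ g) ∘ ⟨ h , k ⟩ ≈ ⟨ f ∘ h , g ∘ k ⟩
  ⁂∘⟨⟩ = ⟨⟩-unique _
    (≈.trans sym-assoc (≈.trans (π₁-β ⟩∘⟨refl) (≈.trans assoc (refl⟩∘⟨ π₁-β))))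
    (≈.trans sym-assoc (≈.trans (π₂-β ⟩∘⟨refl) (≈.trans assoc (refl⟩∘⟨ π₂-β))))

  ⁂∘⁂ : ∀ {a b c d a′ b′} {f : Hom a c} {g : Hom b d} {f′ : Hom a′ a} {g′ : Hom b′ b}
    → (f ⁂ g) ∘ (f′ ⁂ g′) ≈ (f ∘ f′) ⁂ (g ∘ g′)
  ⁂∘⁂ = ≈.trans ⁂∘⟨⟩ (⟨⟩-cong sym-assoc sym-assoc)

  id⁂id : ∀ {a b} → id {a} ⁂ id {b} ≈ id
  id⁂id = ≈.trans (⟨⟩-cong identityˡ identityˡ) ⟨π₁,π₂⟩≈id

  IsIso-⁂ : ∀ {a b c d} {f : Hom a c} {g : Hom b d} → IsIso f → IsIso g → IsIso (f ⁂ g)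
  IsIso-⁂ (f⁻¹ , f⁻¹f , ff⁻¹) (g⁻¹ , g⁻¹g , gg⁻¹) =
    f⁻¹ ⁂ g⁻¹ , ≈.trans ⁂∘⁂ (≈.trans (⁂-cong f⁻¹f g⁻¹g) id⁂id)
              , ≈.trans ⁂∘⁂ (≈.trans (⁂-cong ff⁻¹ gg⁻¹) id⁂id)

module PropCatProperties {𝓛 : Language} {o h e p ℓ₁ ℓ₂ : Level} (X : PropCat 𝓛 o h e p ℓ₁ ℓ₂) where
  open PropCat X public
  open CategoryProperties C public
  open ProductProperties prod public

  module ≈ₚ {c : Obj} = Poset.Eq (P c)
  module ≈ₚ-Reasoning {c : Obj} = SetoidReasoning (Poset.Eq.setoid (P c))

  module _ {c : Obj} where
    open Poset (P c) public using ()
      renaming (reflexive to ≤-reflexive; trans to ≤-trans; antisym to ≤-antisym)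

  ≤-resp-≈ₚ : ∀ {c} {x x′ y y′ : PC c} → x ≈ₚ x′ → y ≈ₚ y′ → x ≤ₚ y → x′ ≤ₚ y′
  ≤-resp-≈ₚ x≈x′ y≈y′ x≤y = ≤-trans (≤-reflexive (≈ₚ.sym x≈x′)) (≤-trans x≤y (≤-reflexive y≈y′))

  Pmap-cong : ∀ {b c} (f : Hom b c) {x y : PC c} → x ≈ₚ y → Pmap f x ≈ₚ Pmap f y
  Pmap-cong f x≈y =
    ≤-antisym (Pmap-mono f (≤-reflexive x≈y)) (Pmap-mono f (≤-reflexive (≈ₚ.sym x≈y)))

  Pmap-resp₂ : ∀ {b c} {f g : Hom b c} {x y : PC c} → f ≈ g → x ≈ₚ y → Pmap f x ≈ₚ Pmap g y
  Pmap-resp₂ {g = g} {x} f≈g x≈y = ≈ₚ.trans (Pmap-resp x f≈g) (Pmap-cong g x≈y)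

  Pmap-∘˘ : ∀ {a b c} (g : Hom b c) (f : Hom a b) (x : PC c) → Pmap f (Pmap g x) ≈ₚ Pmap (g ∘ f) x
  Pmap-∘˘ g f x = ≈ₚ.sym (Pmap-∘ g f x)

  Pmap-inverse : ∀ {a b} {f : Hom a b} {g : Hom b a} (x : PC a) → g ∘ f ≈ id → Pmap f (Pmap g x) ≈ₚ x
  Pmap-inverse {f = f} {g} x gf≈id =
    ≈ₚ.trans (Pmap-∘˘ g f x) (≈ₚ.trans (Pmap-resp x gf≈id) (Pmap-id x))

  Pmap-reflects-≤ : ∀ {a b} {f : Hom a b} {g : Hom b a} → f ∘ g ≈ id → {x y : PC b}
    → Pmap f x ≤ₚ Pmap f y → x ≤ₚ y
  Pmap-reflects-≤ {g = g} fg≈id {x} {y} fx≤fy =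
    ≤-resp-≈ₚ (Pmap-inverse x fg≈id) (Pmap-inverse y fg≈id) (Pmap-mono g fx≤fy)

  Eq-coe : ∀ {a b} (p : a ≡ b) → Pmap (coe p ⁂ coe p) (Eq b) ≈ₚ Eq a
  Eq-coe refl = ≈ₚ.trans (Pmap-resp _ id⁂id) (Pmap-id _)

  Ω-coe : ∀ Q b {c c′} (p : c ≡ c′) (z : PC (b ×ₒ c′)) → Ω Q b c′ z ≈ₚ Ω Q b c (Pmap (id ⁂ coe p) z)
  Ω-coe Q b refl z = Ω-cong Q b _ (≈ₚ.sym (≈ₚ.trans (Pmap-resp z id⁂id) (Pmap-id z)))

  subst-resp : ∀ {a b} (p : a ≡ b) {x y : PC a} → x ≈ₚ y → subst PC p x ≈ₚ subst PC p y
  subst-resp refl x≈y = x≈y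

  subst-cancel : ∀ {a b} (p : a ≡ b) {x y : PC a} → subst PC p x ≈ₚ subst PC p y → x ≈ₚ y
  subst-cancel refl x≈y = x≈y

  subst-mono : ∀ {a b} (p : a ≡ b) {x y : PC a} → x ≤ₚ y → subst PC p x ≤ₚ subst PC p y
  subst-mono refl x≤y = x≤y

module PCMorProperties {𝓛 : Language} {o h e p ℓ₁ ℓ₂ : Level} {X Y : PropCat 𝓛 o h e p ℓ₁ ℓ₂}
                       (F : PCMor X Y) where
  open PCMor F public
  private
    module X = PropCatProperties X
    module Y = PropCatProperties Y
  open Y using (_≈_; _∘_; ⟨_,_⟩; refl⟩∘⟨_; _≈ₚ_)

  aF⁻¹∘aF : ∀ b c → aF⁻¹ b c ∘ aF b c ≈ Y.id
  aF⁻¹∘aF b c = proj₁ (proj₂ (pres-× b c))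

  aF∘aF⁻¹ : ∀ b c → aF b c ∘ aF⁻¹ b c ≈ Y.id
  aF∘aF⁻¹ b c = proj₂ (proj₂ (pres-× b c))

  F₁-∘˘ : ∀ {a b c} {g : X.Hom b c} {f : X.Hom a b} → F₁ g ∘ F₁ f ≈ F₁ (g X.∘ f)
  F₁-∘˘ = Y.≈.sym (F₁-∘ _ _)

  aF∘F₁ : ∀ {a b c} {k : X.Hom c (a X.×ₒ b)} → aF a b ∘ F₁ k ≈ ⟨ F₁ (X.π₁ X.∘ k) , F₁ (X.π₂ X.∘ k) ⟩
  aF∘F₁ = Y.≈.trans Y.⟨⟩∘ (Y.⟨⟩-cong F₁-∘˘ F₁-∘˘)

  aF∘F₁⟨⟩ : ∀ {a b c} {f : X.Hom c a} {g : X.Hom c b} → aF a b ∘ F₁ X.⟨ f , g ⟩ ≈ ⟨ F₁ f , F₁ g ⟩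
  aF∘F₁⟨⟩ = Y.≈.trans aF∘F₁ (Y.⟨⟩-cong (F₁-resp X.π₁-β) (F₁-resp X.π₂-β))

  aF-cancel : ∀ {b c x} {f g : Y.Hom x (F₀ (b X.×ₒ c))} → aF b c ∘ f ≈ aF b c ∘ g → f ≈ g
  aF-cancel {b} {c} aFf≈aFg = Y.≈.trans (Y.≈.sym (Y.cancelˡ (aF⁻¹∘aF b c)))
    (Y.≈.trans (refl⟩∘⟨ aFf≈aFg) (Y.cancelˡ (aF⁻¹∘aF b c)))

  F₁⟨⟩-unique : ∀ {a b c} {f : X.Hom c a} {g : X.Hom c b} (k : X.Hom c (a X.×ₒ b))
    → F₁ (X.π₁ X.∘ k) ≈ F₁ f → F₁ (X.π₂ X.∘ k) ≈ F₁ g → F₁ k ≈ F₁ X.⟨ f , g ⟩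
  F₁⟨⟩-unique k p q = aF-cancel (Y.≈.trans aF∘F₁ (Y.≈.trans (Y.⟨⟩-cong p q) (Y.≈.sym aF∘F₁⟨⟩)))

  Fp-cong : ∀ c {x y : X.PC c} → x X.≈ₚ y → Fp c x ≈ₚ Fp c y
  Fp-cong c x≈y =
    Y.≤-antisym (Fp-mono c (X.≤-reflexive x≈y)) (Fp-mono c (X.≤-reflexive (X.≈ₚ.sym x≈y)))

  F₁-subst₂ : ∀ {a a′ b b′} (p : a ≡ a′) (q : b ≡ b′) (g : X.Hom a b)
    → F₁ (subst₂ X.Hom p q g) ≡ subst₂ Y.Hom (cong F₀ p) (cong F₀ q) (F₁ g)
  F₁-subst₂ refl refl g = refl

  Fp-subst : ∀ {a b} (p : a ≡ b) (x : X.PC a) → Fp b (subst X.PC p x) ≡ subst Y.PC (cong F₀ p) (Fp a x)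
  Fp-subst refl x = refl

  F₁-coe-conjugate : ∀ {x b x′ b′} (P : F₀ x ≡ F₀ b) (P′ : F₀ x′ ≡ F₀ b′) (e : x ≡ b) (e′ : x′ ≡ b′)
    {h : X.Hom x x′} {g : X.Hom b b′} → h X.≈ X.coe (sym e′) X.∘ (g X.∘ X.coe e)
    → subst₂ Y.Hom P P′ (F₁ h) ≈ F₁ g
  F₁-coe-conjugate refl refl refl refl h≈g = F₁-resp (X.≈.trans h≈g (X.≈.trans X.identityˡ X.identityʳ))

  Fp-coe-conjugate : ∀ {x b} (P : F₀ x ≡ F₀ b) (e : x ≡ b) {z : X.PC x} {y : X.PC b}
    → z X.≈ₚ X.Pmap (X.coe e) y → subst Y.PC P (Fp x z) ≈ₚ Fp b y
  Fp-coe-conjugate refl refl {y = y} z≈y = Fp-cong _ (X.≈ₚ.trans z≈y (X.Pmap-id y))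

module _ {𝓛 : Language} {o h e p ℓ₁ ℓ₂ : Level} where

  private
    PCat = PropCat 𝓛 o h e p ℓ₁ ℓ₂

  IsE-inverse : ∀ {X Y : PCat} (F : PCMor X Y) (G : PCMor Y X)
    → (raw G ∘ʳ raw F) ≈ʳ idʳ → (raw F ∘ʳ raw G) ≈ʳ idʳ → IsE F
  IsE-inverse {X} {Y} F G GF≈id FG≈id = injective , surjective , full , surjectiveₚ
    where
      module X = PropCatProperties X
      module Y = PropCatProperties Y
      module F = PCMorProperties F
      module G = PCMor G
      module GF = _≈ʳ_ GF≈id
      module FG = _≈ʳ_ FG≈id

      injective : ∀ {a b} → F.F₀ a ≡ F.F₀ b → a ≡ b
      injective {a} {b} Fa≡Fb = trans (sym (GF.obj a)) (trans (cong G.F₀ Fa≡Fb) (GF.obj b))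

      surjective : ∀ d → ∃ λ c → F.F₀ c ≡ d
      surjective d = G.F₀ d , FG.obj d

      full : ∀ {a b} (g : Y.Hom (F.F₀ a) (F.F₀ b)) → ∃ λ f → F.F₁ f Y.≈ g
      full {a} {b} g = subst₂ X.Hom (GF.obj a) (GF.obj b) (G.F₁ g) , (begin
        F.F₁ (subst₂ X.Hom (GF.obj a) (GF.obj b) (G.F₁ g))
          ≡⟨ F.F₁-subst₂ (GF.obj a) (GF.obj b) (G.F₁ g) ⟩
        subst₂ Y.Hom (cong F.F₀ (GF.obj a)) (cong F.F₀ (GF.obj b)) (F.F₁ (G.F₁ g))
          ≡⟨ cong₂ (λ p q → subst₂ Y.Hom p q (F.F₁ (G.F₁ g))) (uip _ _) (uip _ _) ⟩
        subst₂ Y.Hom (FG.obj (F.F₀ a)) (FG.obj (F.F₀ b)) (F.F₁ (G.F₁ g))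
          ≈⟨ FG.hom g ⟩
        g ∎)
        where open Y.HomReasoning

      surjectiveₚ : ∀ c (y : Y.PC (F.F₀ c)) → ∃ λ x → F.Fp c x Y.≈ₚ y
      surjectiveₚ c y = subst X.PC (GF.obj c) (G.Fp (F.F₀ c) y) , (begin
        F.Fp c (subst X.PC (GF.obj c) (G.Fp (F.F₀ c) y))
          ≡⟨ F.Fp-subst (GF.obj c) _ ⟩
        subst Y.PC (cong F.F₀ (GF.obj c)) (F.Fp _ (G.Fp (F.F₀ c) y))
          ≡⟨ cong (λ p → subst Y.PC p (F.Fp _ (G.Fp (F.F₀ c) y))) (uip _ _) ⟩
        subst Y.PC (FG.obj (F.F₀ c)) (F.Fp _ (G.Fp (F.F₀ c) y))
          ≈⟨ FG.prp (F.F₀ c) y ⟩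
        y ∎)
        where open Y.≈ₚ-Reasoning

  IsM-section : ∀ {X Y : PCat} (F : PCMor X Y) (G : PCMor Y X) → (raw G ∘ʳ raw F) ≈ʳ idʳ → IsM F
  IsM-section {X} {Y} F G GF≈id = faithful , reflects-≤
    where
      module X = PropCatProperties X
      module Y = PropCatProperties Y
      module F = PCMor F
      module G = PCMorProperties G
      module GF = _≈ʳ_ GF≈id

      faithful : ∀ {a b} (f g : X.Hom a b) → F.F₁ f Y.≈ F.F₁ g → f X.≈ g
      faithful {a} {b} f g Ff≈Fg = X.≈.trans (X.≈.sym (GF.hom f))
        (X.≈.trans (X.subst₂-resp (GF.obj a) (GF.obj b) (G.F₁-resp Ff≈Fg)) (GF.hom g))

      reflects-≤ : ∀ c (x y : X.PC c) → F.Fp c x Y.≤ₚ F.Fp c y → x X.≤ₚ y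
      reflects-≤ c x y Fx≤Fy = X.≤-resp-≈ₚ (GF.prp c x) (GF.prp c y)
        (X.subst-mono (GF.obj c) (G.Fp-mono (F.F₀ c) Fx≤Fy))

  IsE-∘ : ∀ {X Y Z : PCat} (F : PCMor X Y) (G : PCMor Y Z) (H : PCMor X Z)
    → IsE F → IsE G → raw H ≈ʳ (raw G ∘ʳ raw F) → IsE H
  IsE-∘ {X} {Y} {Z} F G H (injF , surjF , fullF , surjₚF) (injG , surjG , fullG , surjₚG) H≈GF =
    injective , surjective , full , surjectiveₚ
    where
      module F = PCMor F
      module G = PCMorProperties G
      module H = PCMor H
      module Z = PropCatProperties Z
      module H≈GF = _≈ʳ_ H≈GF

      injective : ∀ {a b} → H.F₀ a ≡ H.F₀ b → a ≡ b
      injective {a} {b} Ha≡Hb = injF (injG (trans (sym (H≈GF.obj a)) (trans Ha≡Hb (H≈GF.obj b))))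

      surjective : ∀ d → ∃ λ c → H.F₀ c ≡ d
      surjective d =
        let (d′ , Gd′≡d) = surjG d
            (c , Fc≡d′) = surjF d′
        in c , trans (H≈GF.obj c) (trans (cong G.F₀ Fc≡d′) Gd′≡d)

      full : ∀ {a b} (g : Z.Hom (H.F₀ a) (H.F₀ b)) → ∃ λ f → H.F₁ f Z.≈ g
      full {a} {b} g =
        let (f′ , Gf′≈g) = fullG (subst₂ Z.Hom (H≈GF.obj a) (H≈GF.obj b) g)
            (f , Ff≈f′) = fullF f′
        in f , Z.subst₂-cancel (H≈GF.obj a) (H≈GF.obj b)
                 (Z.≈.trans (H≈GF.hom f) (Z.≈.trans (G.F₁-resp Ff≈f′) Gf′≈g))

      surjectiveₚ : ∀ c (z : Z.PC (H.F₀ c)) → ∃ λ x → H.Fp c x Z.≈ₚ z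
      surjectiveₚ c z =
        let (y , Gy≈z) = surjₚG (F.F₀ c) (subst Z.PC (H≈GF.obj c) z)
            (x , Fx≈y) = surjₚF c y
        in x , Z.subst-cancel (H≈GF.obj c)
                 (Z.≈ₚ.trans (H≈GF.prp c x) (Z.≈ₚ.trans (G.Fp-cong (F.F₀ c) Fx≈y) Gy≈z))

  IsM-∘ : ∀ {X Y Z : PCat} (F : PCMor X Y) (G : PCMor Y Z) (H : PCMor X Z)
    → IsM F → IsM G → raw H ≈ʳ (raw G ∘ʳ raw F) → IsM H
  IsM-∘ {X} {Y} {Z} F G H (faithfulF , reflectsF) (faithfulG , reflectsG) H≈GF =
    faithful , reflects-≤
    where
      module X = PropCatProperties X
      module Z = PropCatProperties Z
      module F = PCMor F
      module H = PCMor H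
      module H≈GF = _≈ʳ_ H≈GF

      faithful : ∀ {a b} (f g : X.Hom a b) → H.F₁ f Z.≈ H.F₁ g → f X.≈ g
      faithful {a} {b} f g Hf≈Hg = faithfulF f g (faithfulG _ _
        (Z.≈.trans (Z.≈.sym (H≈GF.hom f))
          (Z.≈.trans (Z.subst₂-resp (H≈GF.obj a) (H≈GF.obj b) Hf≈Hg) (H≈GF.hom g))))

      reflects-≤ : ∀ c (x y : X.PC c) → H.Fp c x Z.≤ₚ H.Fp c y → x X.≤ₚ y
      reflects-≤ c x y Hx≤Hy = reflectsF c x y (reflectsG (F.F₀ c) _ _
        (Z.≤-resp-≈ₚ (H≈GF.prp c x) (H≈GF.prp c y) (Z.subst-mono (H≈GF.obj c) Hx≤Hy)))

module Image {𝓛 : Language} {o h e p ℓ₁ ℓ₂ : Level} {X Z : PropCat 𝓛 o h e p ℓ₁ ℓ₂}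
             (F : PCMor X Z) where
  private
    module X = PropCatProperties X
    module Z = PropCatProperties Z
    module F = PCMorProperties F

  imageCategory : Category o h e
  imageCategory = record
    { Obj = X.Obj ; Hom = X.Hom
    ; _≈_ = λ f g → F.F₁ f Z.≈ F.F₁ g
    ; ≈-equiv = record { refl = Z.≈.refl ; sym = Z.≈.sym ; trans = Z.≈.trans }
    ; id = X.id ; _∘_ = X._∘_
    ; ∘-resp-≈ = λ f≈f′ g≈g′ → Z.≈.trans (F.F₁-∘ _ _) (Z.≈.trans (f≈f′ Z.⟩∘⟨ g≈g′) F.F₁-∘˘)
    ; identityˡ = F.F₁-resp X.identityˡ
    ; identityʳ = F.F₁-resp X.identityʳ
    ; assoc = F.F₁-resp X.assoc }

  imageProducts : FinProducts imageCategory
  imageProducts = record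
    { 𝟙 = X.𝟙 ; ! = X.! ; !-unique = λ f → F.F₁-resp (X.!-unique f)
    ; _×ₒ_ = X._×ₒ_ ; π₁ = X.π₁ ; π₂ = X.π₂ ; ⟨_,_⟩ = X.⟨_,_⟩
    ; π₁-β = F.F₁-resp X.π₁-β ; π₂-β = F.F₁-resp X.π₂-β
    ; ⟨⟩-unique = F.F₁⟨⟩-unique }

  _≈ᵢ_ : ∀ {c} → X.PC c → X.PC c → Set ℓ₁
  _≈ᵢ_ {c} x y = F.Fp c x Z.≈ₚ F.Fp c y

  imagePoset : X.Obj → Poset p ℓ₁ ℓ₂
  imagePoset c = record
    { Carrier = X.PC c
    ; _≈_ = _≈ᵢ_
    ; _≤_ = λ x y → F.Fp c x Z.≤ₚ F.Fp c y
    ; isPartialOrder = record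
      { isPreorder = record
        { isEquivalence = record { refl = Z.≈ₚ.refl ; sym = Z.≈ₚ.sym ; trans = Z.≈ₚ.trans }
        ; reflexive = Z.≤-reflexive
        ; trans = Z.≤-trans }
      ; antisym = Z.≤-antisym } }

  Fp-Pointwise : ∀ {c n} {xs ys : Vec (X.PC c) n} → Pointwise _≈ᵢ_ xs ys
    → Pointwise Z._≈ₚ_ (Vec.map (F.Fp c) xs) (Vec.map (F.Fp c) ys)
  Fp-Pointwise [] = []
  Fp-Pointwise (x≈y ∷ xs≈ys) = x≈y ∷ Fp-Pointwise xs≈ys

  ≈ₚ⇒≈ᵢ : ∀ {c} {x y : X.PC c} → x X.≈ₚ y → x ≈ᵢ y
  ≈ₚ⇒≈ᵢ = F.Fp-cong _

  imagePropCat : PropCat 𝓛 o h e p ℓ₁ ℓ₂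
  imagePropCat = record
    { C = imageCategory ; prod = imageProducts ; P = imagePoset
    ; Pmap = X.Pmap
    ; Pmap-mono = λ f Fx≤Fy →
        Z.≤-resp-≈ₚ (F.Fp-nat f _) (F.Fp-nat f _) (Z.Pmap-mono (F.F₁ f) Fx≤Fy)
    ; Pmap-resp = λ x Ff≈Fg →
        Z.≈ₚ.trans (Z.≈ₚ.sym (F.Fp-nat _ x)) (Z.≈ₚ.trans (Z.Pmap-resp _ Ff≈Fg) (F.Fp-nat _ x))
    ; Pmap-id = λ x → ≈ₚ⇒≈ᵢ (X.Pmap-id x)
    ; Pmap-∘ = λ g f x → ≈ₚ⇒≈ᵢ (X.Pmap-∘ g f x)
    ; ops = X.ops
    ; ops-cong = λ c ω xs≈ys → Z.≈ₚ.trans (F.Fp-ops c ω _)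
        (Z.≈ₚ.trans (Z.ops-cong _ ω (Fp-Pointwise xs≈ys)) (Z.≈ₚ.sym (F.Fp-ops c ω _)))
    ; ops-nat = λ f ω xs → ≈ₚ⇒≈ᵢ (X.ops-nat f ω xs)
    ; Eq = X.Eq
    ; Ω = X.Ω
    ; Ω-cong = λ Q b c x≈y → Z.≈ₚ.trans (F.Fp-Ω Q b c _)
        (Z.≈ₚ.trans (Z.Ω-cong Q _ _ (Z.Pmap-cong _ x≈y)) (Z.≈ₚ.sym (F.Fp-Ω Q b c _)))
    ; Ω-nat = λ Q c f x → ≈ₚ⇒≈ᵢ (X.Ω-nat Q c f x)
    ; ⊗-assoc = λ x y z → ≈ₚ⇒≈ᵢ (X.⊗-assoc x y z)
    ; ⊗-unitˡ = λ x → ≈ₚ⇒≈ᵢ (X.⊗-unitˡ x)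
    ; ⊗-unitʳ = λ x → ≈ₚ⇒≈ᵢ (X.⊗-unitʳ x)
    ; Ω-unit = λ Q b x → ≈ₚ⇒≈ᵢ (X.Ω-unit Q b x)
    ; Ω-assoc = λ Q b c d x → ≈ₚ⇒≈ᵢ (X.Ω-assoc Q b c d x)
    ; Eq-𝟙 = ≈ₚ⇒≈ᵢ X.Eq-𝟙
    ; Eq-× = λ c₁ c₂ → ≈ₚ⇒≈ᵢ (X.Eq-× c₁ c₂) }

  toImage : PCMor X imagePropCat
  toImage = record
    { F₀ = λ c → c ; F₁ = λ f → f ; F₁-resp = F.F₁-resp ; F₁-id = Z.≈.refl
    ; F₁-∘ = λ g f → Z.≈.refl
    ; pres-𝟙 = X.! , F.F₁-resp (X.!-unique₂ _ _) , F.F₁-resp (X.!-unique₂ _ _)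
    ; pres-× = λ b c → X.id , F.F₁-resp (X.≈.trans X.identityˡ X.⟨π₁,π₂⟩≈id)
                            , F.F₁-resp (X.≈.trans X.identityʳ X.⟨π₁,π₂⟩≈id)
    ; Fp = λ c x → x
    ; Fp-mono = F.Fp-mono
    ; Fp-nat = λ f x → Z.≈ₚ.refl
    ; Fp-ops = λ c ω xs → Z.≈ₚ.reflexive (cong (λ v → F.Fp c (X.ops c ω v)) (sym (Vec.map-id xs)))
    ; Fp-Ω = λ Q b c x → ≈ₚ⇒≈ᵢ (X.Ω-cong Q b c (X.≈ₚ.sym (X.Pmap-id x)))
    ; Fp-Eq = λ c → ≈ₚ⇒≈ᵢ (X.≈ₚ.sym (X.≈ₚ.trans (X.Pmap-resp _ X.⟨π₁,π₂⟩≈id) (X.Pmap-id _))) }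

  fromImage : PCMor imagePropCat Z
  fromImage = record
    { F₀ = F.F₀ ; F₁ = F.F₁ ; F₁-resp = λ Ff≈Fg → Ff≈Fg ; F₁-id = F.F₁-id ; F₁-∘ = F.F₁-∘
    ; pres-𝟙 = F.pres-𝟙 ; pres-× = F.pres-×
    ; Fp = F.Fp ; Fp-mono = λ c Fx≤Fy → Fx≤Fy ; Fp-nat = F.Fp-nat ; Fp-ops = F.Fp-ops
    ; Fp-Ω = F.Fp-Ω ; Fp-Eq = F.Fp-Eq }

  toImage-IsE : IsE toImage
  toImage-IsE = (λ a≡b → a≡b) , (λ d → d , refl) , (λ g → g , Z.≈.refl) , (λ c y → y , Z.≈ₚ.refl)

  fromImage-IsM : IsM fromImage
  fromImage-IsM = (λ f g Ff≈Fg → Ff≈Fg) , (λ c x y Fx≤Fy → Fx≤Fy)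

  image-factorization : raw F ≈ʳ (raw fromImage ∘ʳ raw toImage)
  image-factorization = record { obj = λ c → refl ; hom = λ f → Z.≈.refl ; prp = λ c x → Z.≈ₚ.refl }

module ImageSemantics {𝓛 : Language} {o h e p ℓ₁ ℓ₂ : Level} {X Z : PropCat 𝓛 o h e p ℓ₁ ℓ₂}
                      (F : PCMor X Z) (Sg : Signature) where
  open Language 𝓛
  open Signature Sg
  open Syntax 𝓛 Sg
  open Image F using (imagePropCat)
  private
    module X = PropCatProperties X
    module Z = PropCatProperties Z
    module F = PCMorProperties F
    module SI = Semantics imagePropCat Sg
    module SZ = Semantics Z Sg
  open Z using (_∘_; _≈_; _⁂_; _⟩∘⟨refl; refl⟩∘⟨_; assoc; sym-assoc; _≈ₚ_)

  module _ (M : SI.Structure) where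
    open SI.Structure M

    comparison : (Γ : Ctx Sort) → Z.Hom (F.F₀ (SI.ctxObj sortI Γ)) (SZ.ctxObj (λ s → F.F₀ (sortI s)) Γ)
    comparison ε = Z.!
    comparison (Γ ▸ s) = (comparison Γ ⁂ Z.id) ∘ F.aF _ _

    comparison-IsIso : (Γ : Ctx Sort) → Z.IsIso (comparison Γ)
    comparison-IsIso ε = F.pres-𝟙
    comparison-IsIso (Γ ▸ s) =
      Z.IsIso-∘ (F.pres-× _ _) (Z.IsIso-⁂ (comparison-IsIso Γ) (Z.id , Z.identityˡ , Z.identityˡ))

    comparison⁻¹ : (Γ : Ctx Sort) → Z.Hom (SZ.ctxObj (λ s → F.F₀ (sortI s)) Γ) (F.F₀ (SI.ctxObj sortI Γ))
    comparison⁻¹ Γ = proj₁ (comparison-IsIso Γ)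

    comparison⁻¹∘comparison : ∀ Γ → comparison⁻¹ Γ ∘ comparison Γ ≈ Z.id
    comparison⁻¹∘comparison Γ = proj₁ (proj₂ (comparison-IsIso Γ))

    comparison∘comparison⁻¹ : ∀ Γ → comparison Γ ∘ comparison⁻¹ Γ ≈ Z.id
    comparison∘comparison⁻¹ Γ = proj₂ (proj₂ (comparison-IsIso Γ))

    pushforward : SZ.Structure
    pushforward = record
      { sortI = λ s → F.F₀ (sortI s)
      ; funI = λ f → F.F₁ (funI f) ∘ comparison⁻¹ (dom f)
      ; relI = λ R → Z.Pmap (comparison⁻¹ (ar R)) (F.Fp _ (relI R)) }

    private
      ⟦_⟧ᵛᵢ = SI.⟦_⟧ᵛ M
      ⟦_⟧ᵗᵢ = SI.⟦_⟧ᵗ M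
      ⟦_⟧ᵗˢᵢ = SI.⟦_⟧ᵗˢ M
      ⟦_⟧ᶠᵢ = SI.⟦_⟧ᶠ M
      ⟦_⟧ᶠˢᵢ = SI.⟦_⟧ᶠˢ M
      ⟦_⟧ᵛ = SZ.⟦_⟧ᵛ pushforward
      ⟦_⟧ᵗ = SZ.⟦_⟧ᵗ pushforward
      ⟦_⟧ᵗˢ = SZ.⟦_⟧ᵗˢ pushforward
      ⟦_⟧ᶠ = SZ.⟦_⟧ᶠ pushforward
      ⟦_⟧ᶠˢ = SZ.⟦_⟧ᶠˢ pushforward

    ⟦⟧ᵛ-comparison : ∀ {Γ s} (x : Γ ∋ s) → ⟦ x ⟧ᵛ ∘ comparison Γ ≈ F.F₁ ⟦ x ⟧ᵛᵢ
    ⟦⟧ᵛ-comparison {Γ ▸ s} here = begin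
      Z.π₂ ∘ ((comparison Γ ⁂ Z.id) ∘ F.aF _ _)  ≈⟨ sym-assoc ⟩
      (Z.π₂ ∘ (comparison Γ ⁂ Z.id)) ∘ F.aF _ _  ≈⟨ Z.π₂-β ⟩∘⟨refl ⟩
      (Z.id ∘ Z.π₂) ∘ F.aF _ _                   ≈⟨ Z.identityˡ ⟩∘⟨refl ⟩
      Z.π₂ ∘ F.aF _ _                            ≈⟨ Z.π₂-β ⟩
      F.F₁ X.π₂                                  ∎
      where open Z.HomReasoning
    ⟦⟧ᵛ-comparison {Γ ▸ s} (there x) = begin
      (⟦ x ⟧ᵛ ∘ Z.π₁) ∘ ((comparison Γ ⁂ Z.id) ∘ F.aF _ _)  ≈⟨ assoc ⟩
      ⟦ x ⟧ᵛ ∘ (Z.π₁ ∘ ((comparison Γ ⁂ Z.id) ∘ F.aF _ _))  ≈⟨ refl⟩∘⟨ sym-assoc ⟩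
      ⟦ x ⟧ᵛ ∘ ((Z.π₁ ∘ (comparison Γ ⁂ Z.id)) ∘ F.aF _ _)  ≈⟨ refl⟩∘⟨ (Z.π₁-β ⟩∘⟨refl) ⟩
      ⟦ x ⟧ᵛ ∘ ((comparison Γ ∘ Z.π₁) ∘ F.aF _ _)           ≈⟨ refl⟩∘⟨ assoc ⟩
      ⟦ x ⟧ᵛ ∘ (comparison Γ ∘ (Z.π₁ ∘ F.aF _ _))           ≈⟨ sym-assoc ⟩
      (⟦ x ⟧ᵛ ∘ comparison Γ) ∘ (Z.π₁ ∘ F.aF _ _)           ≈⟨ ⟦⟧ᵛ-comparison x Z.⟩∘⟨ Z.π₁-β ⟩
      F.F₁ ⟦ x ⟧ᵛᵢ ∘ F.F₁ X.π₁                              ≈⟨ F.F₁-∘˘ ⟩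
      F.F₁ (⟦ x ⟧ᵛᵢ X.∘ X.π₁)                               ∎
      where open Z.HomReasoning

    ⟦⟧ᵗ-comparison : ∀ {Γ s} (t : Term Γ s) → ⟦ t ⟧ᵗ ∘ comparison Γ ≈ F.F₁ ⟦ t ⟧ᵗᵢ
    ⟦⟧ᵗˢ-comparison : ∀ {Γ Δ} (ts : Terms Γ Δ) → ⟦ ts ⟧ᵗˢ ∘ comparison Γ ≈ comparison Δ ∘ F.F₁ ⟦ ts ⟧ᵗˢᵢ
    ⟦⟧ᵗ-comparison (var x) = ⟦⟧ᵛ-comparison x
    ⟦⟧ᵗ-comparison {Γ} (app f ts) = begin
      ((F.F₁ (funI f) ∘ comparison⁻¹ (dom f)) ∘ ⟦ ts ⟧ᵗˢ) ∘ comparison Γ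
        ≈⟨ assoc ⟩
      (F.F₁ (funI f) ∘ comparison⁻¹ (dom f)) ∘ (⟦ ts ⟧ᵗˢ ∘ comparison Γ)
        ≈⟨ refl⟩∘⟨ ⟦⟧ᵗˢ-comparison ts ⟩
      (F.F₁ (funI f) ∘ comparison⁻¹ (dom f)) ∘ (comparison (dom f) ∘ F.F₁ ⟦ ts ⟧ᵗˢᵢ)
        ≈⟨ Z.cancelInner (comparison⁻¹∘comparison (dom f)) ⟩
      F.F₁ (funI f) ∘ F.F₁ ⟦ ts ⟧ᵗˢᵢ
        ≈⟨ F.F₁-∘˘ ⟩
      F.F₁ (funI f X.∘ ⟦ ts ⟧ᵗˢᵢ) ∎
      where open Z.HomReasoning
    ⟦⟧ᵗˢ-comparison []ₜ = Z.!-unique₂ _ _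
    ⟦⟧ᵗˢ-comparison {Γ} (_,ₜ_ {Δ} ts t) = begin
      Z.⟨ ⟦ ts ⟧ᵗˢ , ⟦ t ⟧ᵗ ⟩ ∘ comparison Γ
        ≈⟨ Z.⟨⟩∘ ⟩
      Z.⟨ ⟦ ts ⟧ᵗˢ ∘ comparison Γ , ⟦ t ⟧ᵗ ∘ comparison Γ ⟩
        ≈⟨ Z.⟨⟩-cong (⟦⟧ᵗˢ-comparison ts) (Z.≈.trans (⟦⟧ᵗ-comparison t) (Z.≈.sym Z.identityˡ)) ⟩
      Z.⟨ comparison Δ ∘ F.F₁ ⟦ ts ⟧ᵗˢᵢ , Z.id ∘ F.F₁ ⟦ t ⟧ᵗᵢ ⟩
        ≈⟨ Z.⁂∘⟨⟩ ⟨
      (comparison Δ ⁂ Z.id) ∘ Z.⟨ F.F₁ ⟦ ts ⟧ᵗˢᵢ , F.F₁ ⟦ t ⟧ᵗᵢ ⟩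
        ≈⟨ refl⟩∘⟨ F.aF∘F₁⟨⟩ ⟨
      (comparison Δ ⁂ Z.id) ∘ (F.aF _ _ ∘ F.F₁ X.⟨ ⟦ ts ⟧ᵗˢᵢ , ⟦ t ⟧ᵗᵢ ⟩)
        ≈⟨ sym-assoc ⟩
      ((comparison Δ ⁂ Z.id) ∘ F.aF _ _) ∘ F.F₁ X.⟨ ⟦ ts ⟧ᵗˢᵢ , ⟦ t ⟧ᵗᵢ ⟩ ∎
      where open Z.HomReasoning

    ⟦⟧ᶠ-comparison : ∀ {Γ} (φ : Formula Γ) → Z.Pmap (comparison Γ) ⟦ φ ⟧ᶠ ≈ₚ F.Fp _ ⟦ φ ⟧ᶠᵢ
    ⟦⟧ᶠˢ-comparison : ∀ {Γ n} (φs : Vec (Formula Γ) n)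
      → Pointwise _≈ₚ_ (Vec.map (Z.Pmap (comparison Γ)) ⟦ φs ⟧ᶠˢ) (Vec.map (F.Fp _) ⟦ φs ⟧ᶠˢᵢ)
    ⟦⟧ᶠ-comparison {Γ} (rel R ts) = begin
      Z.Pmap (comparison Γ) (Z.Pmap ⟦ ts ⟧ᵗˢ (Z.Pmap (comparison⁻¹ (ar R)) (F.Fp _ (relI R))))
        ≈⟨ Z.Pmap-∘˘ _ _ _ ⟩
      Z.Pmap (⟦ ts ⟧ᵗˢ ∘ comparison Γ) (Z.Pmap (comparison⁻¹ (ar R)) (F.Fp _ (relI R)))
        ≈⟨ Z.Pmap-∘˘ _ _ _ ⟩
      Z.Pmap (comparison⁻¹ (ar R) ∘ (⟦ ts ⟧ᵗˢ ∘ comparison Γ)) (F.Fp _ (relI R))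
        ≈⟨ Z.Pmap-resp _ (Z.≈.trans (refl⟩∘⟨ ⟦⟧ᵗˢ-comparison ts)
                                      (Z.cancelˡ (comparison⁻¹∘comparison (ar R)))) ⟩
      Z.Pmap (F.F₁ ⟦ ts ⟧ᵗˢᵢ) (F.Fp _ (relI R))
        ≈⟨ F.Fp-nat _ _ ⟩
      F.Fp _ (X.Pmap ⟦ ts ⟧ᵗˢᵢ (relI R)) ∎
      where open Z.≈ₚ-Reasoning
    ⟦⟧ᶠ-comparison {Γ} (eq {s = s} t u) = begin
      Z.Pmap (comparison Γ) (Z.Pmap Z.⟨ ⟦ t ⟧ᵗ , ⟦ u ⟧ᵗ ⟩ (Z.Eq (F.F₀ (sortI s))))
        ≈⟨ Z.Pmap-∘˘ _ _ _ ⟩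
      Z.Pmap (Z.⟨ ⟦ t ⟧ᵗ , ⟦ u ⟧ᵗ ⟩ ∘ comparison Γ) (Z.Eq (F.F₀ (sortI s)))
        ≈⟨ Z.Pmap-resp _ (Z.≈.trans Z.⟨⟩∘ (Z.≈.trans (Z.⟨⟩-cong (⟦⟧ᵗ-comparison t) (⟦⟧ᵗ-comparison u))
                                                     (Z.≈.sym F.aF∘F₁⟨⟩))) ⟩
      Z.Pmap (F.aF _ _ ∘ F.F₁ X.⟨ ⟦ t ⟧ᵗᵢ , ⟦ u ⟧ᵗᵢ ⟩) (Z.Eq (F.F₀ (sortI s)))
        ≈⟨ Z.Pmap-∘ _ _ _ ⟩
      Z.Pmap (F.F₁ X.⟨ ⟦ t ⟧ᵗᵢ , ⟦ u ⟧ᵗᵢ ⟩) (Z.Pmap (F.aF _ _) (Z.Eq (F.F₀ (sortI s))))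
        ≈⟨ Z.Pmap-cong _ (F.Fp-Eq _) ⟨
      Z.Pmap (F.F₁ X.⟨ ⟦ t ⟧ᵗᵢ , ⟦ u ⟧ᵗᵢ ⟩) (F.Fp _ (X.Eq (sortI s)))
        ≈⟨ F.Fp-nat _ _ ⟩
      F.Fp _ (X.Pmap X.⟨ ⟦ t ⟧ᵗᵢ , ⟦ u ⟧ᵗᵢ ⟩ (X.Eq (sortI s))) ∎
      where open Z.≈ₚ-Reasoning
    ⟦⟧ᶠ-comparison (conn ω φs) = Z.≈ₚ.trans (Z.ops-nat _ ω _)
      (Z.≈ₚ.trans (Z.ops-cong _ ω (⟦⟧ᶠˢ-comparison φs)) (Z.≈ₚ.sym (F.Fp-ops _ ω _)))
    ⟦⟧ᶠ-comparison {Γ} (quant Q s φ) = begin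
      Z.Pmap (comparison Γ) (Z.Ω Q _ _ ⟦ φ ⟧ᶠ)
        ≈⟨ Z.Ω-nat Q _ (comparison Γ) _ ⟩
      Z.Ω Q _ _ (Z.Pmap (comparison Γ ⁂ Z.id) ⟦ φ ⟧ᶠ)
        ≈⟨ Z.Ω-cong Q _ _ (Z.≈ₚ.trans (Z.Pmap-∘˘ _ _ _)
                                       (Z.Pmap-resp _ (Z.cancelʳ (F.aF∘aF⁻¹ _ _)))) ⟨
      Z.Ω Q _ _ (Z.Pmap (F.aF⁻¹ _ _) (Z.Pmap ((comparison Γ ⁂ Z.id) ∘ F.aF _ _) ⟦ φ ⟧ᶠ))
        ≈⟨ Z.Ω-cong Q _ _ (Z.Pmap-cong _ (⟦⟧ᶠ-comparison φ)) ⟩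
      Z.Ω Q _ _ (Z.Pmap (F.aF⁻¹ _ _) (F.Fp _ ⟦ φ ⟧ᶠᵢ))
        ≈⟨ F.Fp-Ω Q _ _ _ ⟨
      F.Fp _ (X.Ω Q _ (sortI s) ⟦ φ ⟧ᶠᵢ) ∎
      where open Z.≈ₚ-Reasoning
    ⟦⟧ᶠˢ-comparison [] = []
    ⟦⟧ᶠˢ-comparison (φ ∷ φs) = ⟦⟧ᶠ-comparison φ ∷ ⟦⟧ᶠˢ-comparison φs

    ⨂-comparison : ∀ {Γ} (φs : List (Formula Γ))
      → Z.Pmap (comparison Γ) (SZ.⨂ pushforward φs) ≈ₚ F.Fp _ (SI.⨂ M φs)
    ⨂-comparison [] = Z.≈ₚ.trans (Z.ops-nat _ e⁰ []) (Z.≈ₚ.sym (F.Fp-ops _ e⁰ []))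
    ⨂-comparison (φ ∷ φs) = Z.≈ₚ.trans (Z.ops-nat _ ⊗² _)
      (Z.≈ₚ.trans (Z.ops-cong _ ⊗² (⟦⟧ᶠ-comparison φ ∷ ⨂-comparison φs ∷ []))
                  (Z.≈ₚ.sym (F.Fp-ops _ ⊗² _)))

    Sat-pushforward : ∀ a → SI.Sat M a → SZ.Sat pushforward a
    Sat-pushforward (equation Γ s t u) (lift Ft≈Fu) = lift (begin
      ⟦ t ⟧ᵗ                                 ≈⟨ Z.cancelʳ (comparison∘comparison⁻¹ Γ) ⟨
      (⟦ t ⟧ᵗ ∘ comparison Γ) ∘ comparison⁻¹ Γ  ≈⟨ ⟦⟧ᵗ-comparison t ⟩∘⟨refl ⟩
      F.F₁ ⟦ t ⟧ᵗᵢ ∘ comparison⁻¹ Γ             ≈⟨ Ft≈Fu ⟩∘⟨refl ⟩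
      F.F₁ ⟦ u ⟧ᵗᵢ ∘ comparison⁻¹ Γ             ≈⟨ ⟦⟧ᵗ-comparison u ⟩∘⟨refl ⟨
      (⟦ u ⟧ᵗ ∘ comparison Γ) ∘ comparison⁻¹ Γ  ≈⟨ Z.cancelʳ (comparison∘comparison⁻¹ Γ) ⟩
      ⟦ u ⟧ᵗ                                 ∎)
      where open Z.HomReasoning
    Sat-pushforward (sequent Γ φs φ) (lift ⨂≤φ) = lift (Z.Pmap-reflects-≤ (comparison∘comparison⁻¹ Γ)
      (Z.≤-resp-≈ₚ (Z.≈ₚ.sym (⨂-comparison φs)) (Z.≈ₚ.sym (⟦⟧ᶠ-comparison φ)) ⨂≤φ))

    Sat-pullback : ∀ a → SZ.Sat pushforward a → SI.Sat M a
    Sat-pullback (equation Γ s t u) (lift t≈u) = lift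
      (Z.≈.trans (Z.≈.sym (⟦⟧ᵗ-comparison t)) (Z.≈.trans (t≈u ⟩∘⟨refl) (⟦⟧ᵗ-comparison u)))
    Sat-pullback (sequent Γ φs φ) (lift ⨂≤φ) = lift
      (Z.≤-resp-≈ₚ (⨂-comparison φs) (⟦⟧ᶠ-comparison φ) (Z.Pmap-mono (comparison Γ) ⨂≤φ))

image-InFA : ∀ {𝓛 : Language} {o h e p ℓ₁ ℓ₂ : Level} {X Z : PropCat 𝓛 o h e p ℓ₁ ℓ₂}
  (L : Logic 𝓛) (F : PCMor X Z) → InFA L Z → InFA L (Image.imagePropCat F)
image-InFA L F Z∈FA Sg T T′ T⊢T′ M M⊨T a a∈T′ =
  Sat-pullback M a (Z∈FA Sg T T′ T⊢T′ (pushforward M) (λ b b∈T → Sat-pushforward M b (M⊨T b b∈T)) a a∈T′)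
  where open ImageSemantics F Sg

module Diagonal {𝓛 : Language} {o h e p ℓ₁ ℓ₂ : Level} {A B C D : PropCat 𝓛 o h e p ℓ₁ ℓ₂}
  (k : PCMor A B) (u : PCMor A C) (m : PCMor C D) (v : PCMor B D)
  (k∈ℰ : IsE k) (m∈ℳ : IsM m) (square : (raw v ∘ʳ raw k) ≈ʳ (raw m ∘ʳ raw u)) where
  open Language 𝓛
  private
    module A = PropCatProperties A
    module B = PropCatProperties B
    module C = PropCatProperties C
    module D = PropCatProperties D
    module k = PCMorProperties k
    module u = PCMorProperties u
    module v = PCMorProperties v
    module square = _≈ʳ_ square
  open B using (_∘_; _≈_; _⁂_; _⟩∘⟨_; refl⟩∘⟨_; _⟩∘⟨refl; assoc; sym-assoc; _≈ₚ_)

  u₁-resp-k₁ : ∀ {a a′} (f g : A.Hom a a′) → k.F₁ f ≈ k.F₁ g → u.F₁ f C.≈ u.F₁ g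
  u₁-resp-k₁ {a} {a′} f g kf≈kg = proj₁ m∈ℳ (u.F₁ f) (u.F₁ g)
    (D.≈.trans (D.≈.sym (square.hom f))
      (D.≈.trans (D.subst₂-resp (square.obj a) (square.obj a′) (v.F₁-resp kf≈kg)) (square.hom g)))

  uₚ-resp-kₚ-≤ : ∀ c {x y : A.PC c} → k.Fp c x B.≤ₚ k.Fp c y → u.Fp c x C.≤ₚ u.Fp c y
  uₚ-resp-kₚ-≤ c {x} {y} kx≤ky = proj₂ m∈ℳ _ _ _
    (D.≤-resp-≈ₚ (square.prp c x) (square.prp c y) (D.subst-mono (square.obj c) (v.Fp-mono _ kx≤ky)))

  uₚ-resp-kₚ : ∀ c {x y : A.PC c} → k.Fp c x ≈ₚ k.Fp c y → u.Fp c x C.≈ₚ u.Fp c y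
  uₚ-resp-kₚ c kx≈ky =
    C.≤-antisym (uₚ-resp-kₚ-≤ c (B.≤-reflexive kx≈ky)) (uₚ-resp-kₚ-≤ c (B.≤-reflexive (B.≈ₚ.sym kx≈ky)))

  k₀⁻¹ : B.Obj → A.Obj
  k₀⁻¹ b = proj₁ (proj₁ (proj₂ k∈ℰ) b)

  k₀∘k₀⁻¹ : ∀ b → k.F₀ (k₀⁻¹ b) ≡ b
  k₀∘k₀⁻¹ b = proj₂ (proj₁ (proj₂ k∈ℰ) b)

  k₀⁻¹∘k₀ : ∀ a → k₀⁻¹ (k.F₀ a) ≡ a
  k₀⁻¹∘k₀ a = proj₁ k∈ℰ (k₀∘k₀⁻¹ (k.F₀ a))

  τ : ∀ b → B.Hom (k.F₀ (k₀⁻¹ b)) b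
  τ b = B.coe (k₀∘k₀⁻¹ b)

  τ-IsIso : ∀ b → B.IsIso (τ b)
  τ-IsIso b = B.IsIso-coe (k₀∘k₀⁻¹ b)

  τ⁻¹ : ∀ b → B.Hom b (k.F₀ (k₀⁻¹ b))
  τ⁻¹ b = proj₁ (τ-IsIso b)

  τ⁻¹∘τ : ∀ b → τ⁻¹ b ∘ τ b ≈ B.id
  τ⁻¹∘τ b = proj₁ (proj₂ (τ-IsIso b))

  τ∘τ⁻¹ : ∀ b → τ b ∘ τ⁻¹ b ≈ B.id
  τ∘τ⁻¹ b = proj₂ (proj₂ (τ-IsIso b))

  k₁⁻¹ : ∀ {a a′} → B.Hom (k.F₀ a) (k.F₀ a′) → A.Hom a a′
  k₁⁻¹ g = proj₁ (proj₁ (proj₂ (proj₂ k∈ℰ)) g)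

  k₁∘k₁⁻¹ : ∀ {a a′} (g : B.Hom (k.F₀ a) (k.F₀ a′)) → k.F₁ (k₁⁻¹ g) ≈ g
  k₁∘k₁⁻¹ g = proj₂ (proj₁ (proj₂ (proj₂ k∈ℰ)) g)

  kₚ⁻¹ : ∀ c → B.PC (k.F₀ c) → A.PC c
  kₚ⁻¹ c y = proj₁ (proj₂ (proj₂ (proj₂ k∈ℰ)) c y)

  kₚ∘kₚ⁻¹ : ∀ c (y : B.PC (k.F₀ c)) → k.Fp c (kₚ⁻¹ c y) ≈ₚ y
  kₚ∘kₚ⁻¹ c y = proj₂ (proj₂ (proj₂ (proj₂ k∈ℰ)) c y)

  transfer₁ : ∀ {a a′} → B.Hom (k.F₀ a) (k.F₀ a′) → C.Hom (u.F₀ a) (u.F₀ a′)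
  transfer₁ g = u.F₁ (k₁⁻¹ g)

  transfer₁-resp : ∀ {a a′} {g g′ : B.Hom (k.F₀ a) (k.F₀ a′)} → g ≈ g′ → transfer₁ g C.≈ transfer₁ g′
  transfer₁-resp g≈g′ = u₁-resp-k₁ _ _ (B.≈.trans (k₁∘k₁⁻¹ _) (B.≈.trans g≈g′ (B.≈.sym (k₁∘k₁⁻¹ _))))

  transfer₁-k₁ : ∀ {a a′} (f : A.Hom a a′) → transfer₁ (k.F₁ f) C.≈ u.F₁ f
  transfer₁-k₁ f = u₁-resp-k₁ _ _ (k₁∘k₁⁻¹ _)

  transfer₁-∘ : ∀ {a a′ a″} (g : B.Hom (k.F₀ a′) (k.F₀ a″)) (f : B.Hom (k.F₀ a) (k.F₀ a′))
    → transfer₁ (g ∘ f) C.≈ transfer₁ g C.∘ transfer₁ f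
  transfer₁-∘ g f = C.≈.trans
    (u₁-resp-k₁ _ _ (B.≈.trans (k₁∘k₁⁻¹ _) (B.≈.trans (B.≈.sym (k₁∘k₁⁻¹ g ⟩∘⟨ k₁∘k₁⁻¹ f)) k.F₁-∘˘)))
    (u.F₁-∘ _ _)

  transfer₁-id : ∀ {a} → transfer₁ (B.id {k.F₀ a}) C.≈ C.id
  transfer₁-id = C.≈.trans (u₁-resp-k₁ _ _ (B.≈.trans (k₁∘k₁⁻¹ _) (B.≈.sym k.F₁-id))) u.F₁-id

  transfer₁-IsIso : ∀ {a a′} {f : B.Hom (k.F₀ a) (k.F₀ a′)} {g : B.Hom (k.F₀ a′) (k.F₀ a)}
    → g ∘ f ≈ B.id → f ∘ g ≈ B.id → C.IsIso (transfer₁ f)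
  transfer₁-IsIso {f = f} {g} gf≈id fg≈id = transfer₁ g ,
    C.≈.trans (C.≈.sym (transfer₁-∘ g f)) (C.≈.trans (transfer₁-resp gf≈id) transfer₁-id) ,
    C.≈.trans (C.≈.sym (transfer₁-∘ f g)) (C.≈.trans (transfer₁-resp fg≈id) transfer₁-id)

  transferₚ : ∀ c → B.PC (k.F₀ c) → C.PC (u.F₀ c)
  transferₚ c y = u.Fp c (kₚ⁻¹ c y)

  transferₚ-resp : ∀ c {y y′ : B.PC (k.F₀ c)} → y ≈ₚ y′ → transferₚ c y C.≈ₚ transferₚ c y′
  transferₚ-resp c y≈y′ =
    uₚ-resp-kₚ c (B.≈ₚ.trans (kₚ∘kₚ⁻¹ c _) (B.≈ₚ.trans y≈y′ (B.≈ₚ.sym (kₚ∘kₚ⁻¹ c _))))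

  transferₚ-kₚ : ∀ c (x : A.PC c) → transferₚ c (k.Fp c x) C.≈ₚ u.Fp c x
  transferₚ-kₚ c x = uₚ-resp-kₚ c (kₚ∘kₚ⁻¹ c _)

  w₀ : B.Obj → C.Obj
  w₀ b = u.F₀ (k₀⁻¹ b)

  conjugate : ∀ {b b′} → B.Hom b b′ → B.Hom (k.F₀ (k₀⁻¹ b)) (k.F₀ (k₀⁻¹ b′))
  conjugate {b} {b′} g = τ⁻¹ b′ ∘ (g ∘ τ b)

  w₁ : ∀ {b b′} → B.Hom b b′ → C.Hom (w₀ b) (w₀ b′)
  w₁ g = transfer₁ (conjugate g)

  wₚ : ∀ b → B.PC b → C.PC (w₀ b)
  wₚ b y = transferₚ (k₀⁻¹ b) (B.Pmap (τ b) y)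

  conjugate-id : ∀ {b} → conjugate (B.id {b}) ≈ B.id
  conjugate-id {b} = B.≈.trans (refl⟩∘⟨ B.identityˡ) (τ⁻¹∘τ b)

  conjugate-∘ : ∀ {a b c} (g : B.Hom b c) (f : B.Hom a b) → conjugate (g ∘ f) ≈ conjugate g ∘ conjugate f
  conjugate-∘ {a} {b} {c} g f = B.≈.sym (begin
    (τ⁻¹ c ∘ (g ∘ τ b)) ∘ (τ⁻¹ b ∘ (f ∘ τ a))  ≈⟨ assoc ⟩
    τ⁻¹ c ∘ ((g ∘ τ b) ∘ (τ⁻¹ b ∘ (f ∘ τ a)))  ≈⟨ refl⟩∘⟨ assoc ⟩
    τ⁻¹ c ∘ (g ∘ (τ b ∘ (τ⁻¹ b ∘ (f ∘ τ a))))  ≈⟨ refl⟩∘⟨ (refl⟩∘⟨ B.cancelˡ (τ∘τ⁻¹ b)) ⟩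
    τ⁻¹ c ∘ (g ∘ (f ∘ τ a))                    ≈⟨ refl⟩∘⟨ sym-assoc ⟩
    τ⁻¹ c ∘ ((g ∘ f) ∘ τ a)                    ∎)
    where open B.HomReasoning

  w₁-resp : ∀ {b b′} {g g′ : B.Hom b b′} → g ≈ g′ → w₁ g C.≈ w₁ g′
  w₁-resp g≈g′ = transfer₁-resp (refl⟩∘⟨ (g≈g′ ⟩∘⟨refl))

  w₁-id : ∀ {b} → w₁ (B.id {b}) C.≈ C.id
  w₁-id = C.≈.trans (transfer₁-resp conjugate-id) transfer₁-id

  w₁-∘ : ∀ {a b c} (g : B.Hom b c) (f : B.Hom a b) → w₁ (g ∘ f) C.≈ w₁ g C.∘ w₁ f
  w₁-∘ g f = C.≈.trans (transfer₁-resp (conjugate-∘ g f)) (transfer₁-∘ _ _)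

  w-pres-𝟙 : C.IsIso (C.! {w₀ B.𝟙})
  w-pres-𝟙 = C.IsIso-resp (C.!-unique₂ _ _)
    (C.IsIso-∘ (transfer₁-IsIso {f = ψ} {φ} φ∘ψ≈id ψ∘φ≈id) u.pres-𝟙)
    where
      φ : B.Hom (k.F₀ A.𝟙) (k.F₀ (k₀⁻¹ B.𝟙))
      φ = τ⁻¹ B.𝟙 ∘ B.!
      ψ : B.Hom (k.F₀ (k₀⁻¹ B.𝟙)) (k.F₀ A.𝟙)
      ψ = proj₁ k.pres-𝟙 ∘ τ B.𝟙
      ψ∘φ≈id : ψ ∘ φ ≈ B.id
      ψ∘φ≈id = B.≈.trans (B.cancelInner (τ∘τ⁻¹ B.𝟙)) (proj₁ (proj₂ k.pres-𝟙))
      φ∘ψ≈id : φ ∘ ψ ≈ B.id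
      φ∘ψ≈id = B.≈.trans (B.cancelInner (B.!-unique₂ _ _)) (τ⁻¹∘τ B.𝟙)

  module BinaryProduct (b c : B.Obj) where
    a = k₀⁻¹ b
    a′ = k₀⁻¹ c

    ψ : B.Hom (k.F₀ (k₀⁻¹ (b B.×ₒ c))) (k.F₀ (a A.×ₒ a′))
    ψ = k.aF⁻¹ a a′ ∘ ((τ⁻¹ b ⁂ τ⁻¹ c) ∘ τ (b B.×ₒ c))

    ψ-IsIso : B.IsIso ψ
    ψ-IsIso = B.IsIso-∘ (B.IsIso-∘ (τ-IsIso (b B.×ₒ c)) τ⁻¹⁂τ⁻¹-IsIso) (B.IsIso-inverse (k.pres-× a a′))
      where
        τ⁻¹⁂τ⁻¹-IsIso : B.IsIso (τ⁻¹ b ⁂ τ⁻¹ c)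
        τ⁻¹⁂τ⁻¹-IsIso = B.IsIso-⁂ (B.IsIso-inverse (τ-IsIso b)) (B.IsIso-inverse (τ-IsIso c))

    k₁π₁∘ψ : k.F₁ A.π₁ ∘ ψ ≈ conjugate B.π₁
    k₁π₁∘ψ = begin
      k.F₁ A.π₁ ∘ (k.aF⁻¹ a a′ ∘ ((τ⁻¹ b ⁂ τ⁻¹ c) ∘ τ (b B.×ₒ c)))
        ≈⟨ B.π₁-β ⟩∘⟨refl ⟨
      (B.π₁ ∘ k.aF a a′) ∘ (k.aF⁻¹ a a′ ∘ ((τ⁻¹ b ⁂ τ⁻¹ c) ∘ τ (b B.×ₒ c)))
        ≈⟨ B.cancelInner (k.aF∘aF⁻¹ a a′) ⟩
      B.π₁ ∘ ((τ⁻¹ b ⁂ τ⁻¹ c) ∘ τ (b B.×ₒ c))  ≈⟨ sym-assoc ⟩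
      (B.π₁ ∘ (τ⁻¹ b ⁂ τ⁻¹ c)) ∘ τ (b B.×ₒ c)  ≈⟨ B.π₁-β ⟩∘⟨refl ⟩
      (τ⁻¹ b ∘ B.π₁) ∘ τ (b B.×ₒ c)            ≈⟨ assoc ⟩
      τ⁻¹ b ∘ (B.π₁ ∘ τ (b B.×ₒ c))            ∎
      where open B.HomReasoning

    k₁π₂∘ψ : k.F₁ A.π₂ ∘ ψ ≈ conjugate B.π₂
    k₁π₂∘ψ = begin
      k.F₁ A.π₂ ∘ (k.aF⁻¹ a a′ ∘ ((τ⁻¹ b ⁂ τ⁻¹ c) ∘ τ (b B.×ₒ c)))
        ≈⟨ B.π₂-β ⟩∘⟨refl ⟨
      (B.π₂ ∘ k.aF a a′) ∘ (k.aF⁻¹ a a′ ∘ ((τ⁻¹ b ⁂ τ⁻¹ c) ∘ τ (b B.×ₒ c)))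
        ≈⟨ B.cancelInner (k.aF∘aF⁻¹ a a′) ⟩
      B.π₂ ∘ ((τ⁻¹ b ⁂ τ⁻¹ c) ∘ τ (b B.×ₒ c))  ≈⟨ sym-assoc ⟩
      (B.π₂ ∘ (τ⁻¹ b ⁂ τ⁻¹ c)) ∘ τ (b B.×ₒ c)  ≈⟨ B.π₂-β ⟩∘⟨refl ⟩
      (τ⁻¹ c ∘ B.π₂) ∘ τ (b B.×ₒ c)            ≈⟨ assoc ⟩
      τ⁻¹ c ∘ (B.π₂ ∘ τ (b B.×ₒ c))            ∎
      where open B.HomReasoning

    aw≈aF∘transfer₁ψ : C.⟨ w₁ B.π₁ , w₁ B.π₂ ⟩ C.≈ u.aF a a′ C.∘ transfer₁ ψ
    aw≈aF∘transfer₁ψ =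
      C.≈.sym (C.⟨⟩-unique _ (projection A.π₁ k₁π₁∘ψ C.π₁-β) (projection A.π₂ k₁π₂∘ψ C.π₂-β))
      where
        projection : ∀ {a″} (π : A.Hom (a A.×ₒ a′) a″) {g : B.Hom _ (k.F₀ a″)} {π′ : C.Hom _ (u.F₀ a″)}
          → k.F₁ π ∘ ψ ≈ g → π′ C.∘ u.aF a a′ C.≈ u.F₁ π
          → π′ C.∘ (u.aF a a′ C.∘ transfer₁ ψ) C.≈ transfer₁ g
        projection π kπ∘ψ≈g π′∘aF≈uπ = C.≈.trans C.sym-assoc (C.≈.trans (π′∘aF≈uπ C.⟩∘⟨refl)
          (C.≈.trans (C.≈.sym (transfer₁-k₁ π) C.⟩∘⟨refl)
            (C.≈.trans (C.≈.sym (transfer₁-∘ _ _)) (transfer₁-resp kπ∘ψ≈g))))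

    aw-IsIso : C.IsIso C.⟨ w₁ B.π₁ , w₁ B.π₂ ⟩
    aw-IsIso = C.IsIso-resp (C.≈.sym aw≈aF∘transfer₁ψ)
      (C.IsIso-∘ (transfer₁-IsIso (proj₁ (proj₂ ψ-IsIso)) (proj₂ (proj₂ ψ-IsIso))) (u.pres-× a a′))

    τ∘ψ⁻¹∘aF⁻¹ : (τ (b B.×ₒ c) ∘ proj₁ ψ-IsIso) ∘ k.aF⁻¹ a a′ ≈ τ b ⁂ τ c
    τ∘ψ⁻¹∘aF⁻¹ = begin
      (τ (b B.×ₒ c) ∘ ((τ⁻¹ (b B.×ₒ c) ∘ (τ b ⁂ τ c)) ∘ k.aF a a′)) ∘ k.aF⁻¹ a a′
        ≈⟨ sym-assoc ⟩∘⟨refl ⟩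
      ((τ (b B.×ₒ c) ∘ (τ⁻¹ (b B.×ₒ c) ∘ (τ b ⁂ τ c))) ∘ k.aF a a′) ∘ k.aF⁻¹ a a′
        ≈⟨ B.cancelʳ (k.aF∘aF⁻¹ a a′) ⟩
      τ (b B.×ₒ c) ∘ (τ⁻¹ (b B.×ₒ c) ∘ (τ b ⁂ τ c))
        ≈⟨ B.cancelˡ (τ∘τ⁻¹ (b B.×ₒ c)) ⟩
      τ b ⁂ τ c ∎
      where open B.HomReasoning

  wₚ-mono : ∀ b {y y′ : B.PC b} → y B.≤ₚ y′ → wₚ b y C.≤ₚ wₚ b y′
  wₚ-mono b y≤y′ = uₚ-resp-kₚ-≤ (k₀⁻¹ b)
    (B.≤-resp-≈ₚ (B.≈ₚ.sym (kₚ∘kₚ⁻¹ _ _)) (B.≈ₚ.sym (kₚ∘kₚ⁻¹ _ _)) (B.Pmap-mono (τ b) y≤y′))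

  wₚ-nat : ∀ {b b′} (g : B.Hom b b′) (y : B.PC b′) → C.Pmap (w₁ g) (wₚ b′ y) C.≈ₚ wₚ b (B.Pmap g y)
  wₚ-nat {b} {b′} g y = C.≈ₚ.trans (u.Fp-nat _ _) (uₚ-resp-kₚ _ (begin
    k.Fp _ (A.Pmap (k₁⁻¹ (conjugate g)) (kₚ⁻¹ _ (B.Pmap (τ b′) y)))
      ≈⟨ k.Fp-nat _ _ ⟨
    B.Pmap (k.F₁ (k₁⁻¹ (conjugate g))) (k.Fp _ (kₚ⁻¹ _ (B.Pmap (τ b′) y)))
      ≈⟨ B.Pmap-resp₂ (k₁∘k₁⁻¹ _) (kₚ∘kₚ⁻¹ _ _) ⟩
    B.Pmap (conjugate g) (B.Pmap (τ b′) y)  ≈⟨ B.Pmap-∘˘ _ _ _ ⟩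
    B.Pmap (τ b′ ∘ conjugate g) y           ≈⟨ B.Pmap-resp _ (B.cancelˡ (τ∘τ⁻¹ b′)) ⟩
    B.Pmap (g ∘ τ b) y                      ≈⟨ B.Pmap-∘ _ _ _ ⟩
    B.Pmap (τ b) (B.Pmap g y)               ≈⟨ kₚ∘kₚ⁻¹ _ _ ⟨
    k.Fp _ (kₚ⁻¹ _ (B.Pmap (τ b) (B.Pmap g y))) ∎))
    where open B.≈ₚ-Reasoning

  wₚ-ops : ∀ {n} b (ω : Conn n) (ys : Vec (B.PC b) n)
    → wₚ b (B.ops b ω ys) C.≈ₚ C.ops (w₀ b) ω (Vec.map (wₚ b) ys)
  wₚ-ops b ω ys = C.≈ₚ.trans
    (uₚ-resp-kₚ _ (B.≈ₚ.trans (kₚ∘kₚ⁻¹ _ _) (B.≈ₚ.trans (B.ops-nat _ ω ys)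
      (B.≈ₚ.trans (B.ops-cong _ ω (τ-kₚ∘kₚ⁻¹ ys)) (B.≈ₚ.sym (k.Fp-ops _ ω _))))))
    (C.≈ₚ.trans (u.Fp-ops _ ω _)
      (C.≈ₚ.reflexive (cong (C.ops (w₀ b) ω) (sym (Vec.map-∘ (u.Fp (k₀⁻¹ b)) _ ys)))))
    where
      τ-kₚ∘kₚ⁻¹ : ∀ {n} (ys : Vec (B.PC b) n) → Pointwise _≈ₚ_ (Vec.map (B.Pmap (τ b)) ys)
        (Vec.map (k.Fp (k₀⁻¹ b)) (Vec.map (λ y → kₚ⁻¹ (k₀⁻¹ b) (B.Pmap (τ b) y)) ys))
      τ-kₚ∘kₚ⁻¹ [] = []
      τ-kₚ∘kₚ⁻¹ (y ∷ ys) = B.≈ₚ.sym (kₚ∘kₚ⁻¹ _ _) ∷ τ-kₚ∘kₚ⁻¹ ys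

  wₚ-Ω : ∀ Q b c (y : B.PC (b B.×ₒ c))
    → wₚ b (B.Ω Q b c y)
      C.≈ₚ C.Ω Q (w₀ b) (w₀ c) (C.Pmap (proj₁ (BinaryProduct.aw-IsIso b c)) (wₚ (b B.×ₒ c) y))
  wₚ-Ω Q b c y = C.≈ₚ.trans (uₚ-resp-kₚ a (begin
    k.Fp a (kₚ⁻¹ a (B.Pmap (τ b) (B.Ω Q b c y)))
      ≈⟨ kₚ∘kₚ⁻¹ _ _ ⟩
    B.Pmap (τ b) (B.Ω Q b c y)
      ≈⟨ B.Ω-nat Q c (τ b) y ⟩
    B.Ω Q _ c (B.Pmap (τ b ⁂ B.id) y)
      ≈⟨ B.Ω-coe Q _ (k₀∘k₀⁻¹ c) _ ⟩
    B.Ω Q _ _ (B.Pmap (B.id ⁂ τ c) (B.Pmap (τ b ⁂ B.id) y))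
      ≈⟨ B.Ω-cong Q _ _ (B.≈ₚ.trans (B.Pmap-∘˘ _ _ _)
           (B.Pmap-resp _ (B.≈.trans B.⁂∘⁂ (B.⁂-cong B.identityʳ B.identityˡ)))) ⟩
    B.Ω Q _ _ (B.Pmap (τ b ⁂ τ c) y)
      ≈⟨ B.Ω-cong Q _ _ (B.≈ₚ.trans (B.Pmap-∘˘ _ _ _) (B.≈ₚ.trans (B.Pmap-∘˘ _ _ _)
           (B.Pmap-resp _ (B.≈.trans sym-assoc τ∘ψ⁻¹∘aF⁻¹)))) ⟨
    B.Ω Q _ _ (B.Pmap (k.aF⁻¹ a a′) (B.Pmap ψ⁻¹ (B.Pmap (τ (b B.×ₒ c)) y)))
      ≈⟨ B.Ω-cong Q _ _ (B.Pmap-cong _ (B.≈ₚ.trans (B.≈ₚ.sym (k.Fp-nat _ _))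
           (B.Pmap-resp₂ (k₁∘k₁⁻¹ ψ⁻¹) (kₚ∘kₚ⁻¹ _ _)))) ⟨
    B.Ω Q _ _ (B.Pmap (k.aF⁻¹ a a′) (k.Fp _ (A.Pmap (k₁⁻¹ ψ⁻¹) (kₚ⁻¹ _ (B.Pmap (τ (b B.×ₒ c)) y)))))
      ≈⟨ k.Fp-Ω Q a a′ _ ⟨
    k.Fp a (A.Ω Q a a′ (A.Pmap (k₁⁻¹ ψ⁻¹) (kₚ⁻¹ _ (B.Pmap (τ (b B.×ₒ c)) y)))) ∎))
    (C.≈ₚ.trans (u.Fp-Ω Q a a′ _)
      (C.Ω-cong Q _ _ (C.≈ₚ.trans (C.Pmap-cong _ (C.≈ₚ.sym (u.Fp-nat _ _))) (C.Pmap-∘˘ _ _ _))))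
    where
      open BinaryProduct b c
      open B.≈ₚ-Reasoning
      ψ⁻¹ = proj₁ ψ-IsIso

  wₚ-Eq : ∀ b → wₚ (b B.×ₒ b) (B.Eq b) C.≈ₚ C.Pmap C.⟨ w₁ B.π₁ , w₁ B.π₂ ⟩ (C.Eq (w₀ b))
  wₚ-Eq b = C.≈ₚ.trans (uₚ-resp-kₚ _ (begin
    k.Fp _ (kₚ⁻¹ _ (B.Pmap (τ (b B.×ₒ b)) (B.Eq b)))
      ≈⟨ kₚ∘kₚ⁻¹ _ _ ⟩
    B.Pmap (τ (b B.×ₒ b)) (B.Eq b)
      ≈⟨ B.Pmap-resp _ τ⁂τ∘aF∘ψ ⟨
    B.Pmap (((τ b ⁂ τ b) ∘ k.aF a a) ∘ ψ) (B.Eq b)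
      ≈⟨ B.≈ₚ.trans (B.Pmap-cong ψ (B.Pmap-∘˘ (τ b ⁂ τ b) (k.aF a a) _)) (B.Pmap-∘˘ _ ψ _) ⟨
    B.Pmap ψ (B.Pmap (k.aF a a) (B.Pmap (τ b ⁂ τ b) (B.Eq b)))
      ≈⟨ B.Pmap-cong ψ (B.Pmap-cong _ (B.Eq-coe (k₀∘k₀⁻¹ b))) ⟩
    B.Pmap ψ (B.Pmap (k.aF a a) (B.Eq (k.F₀ a)))
      ≈⟨ B.Pmap-cong ψ (k.Fp-Eq a) ⟨
    B.Pmap ψ (k.Fp _ (A.Eq a))
      ≈⟨ B.Pmap-resp _ (k₁∘k₁⁻¹ ψ) ⟨
    B.Pmap (k.F₁ (k₁⁻¹ ψ)) (k.Fp _ (A.Eq a))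
      ≈⟨ k.Fp-nat _ _ ⟩
    k.Fp _ (A.Pmap (k₁⁻¹ ψ) (A.Eq a)) ∎))
    (C.≈ₚ.sym (C.≈ₚ.trans (C.Pmap-resp _ aw≈aF∘transfer₁ψ) (C.≈ₚ.trans (C.Pmap-∘ _ _ _)
      (C.≈ₚ.trans (C.Pmap-cong _ (C.≈ₚ.sym (u.Fp-Eq a))) (u.Fp-nat _ _)))))
    where
      open BinaryProduct b b
      open B.≈ₚ-Reasoning
      τ⁂τ∘aF∘ψ : ((τ b ⁂ τ b) ∘ k.aF a a) ∘ ψ ≈ τ (b B.×ₒ b)
      τ⁂τ∘aF∘ψ = B.≈.trans (B.cancelInner (k.aF∘aF⁻¹ a a)) (B.≈.trans sym-assoc
        (B.≈.trans (B.≈.trans B.⁂∘⁂ (B.≈.trans (B.⁂-cong (τ∘τ⁻¹ b) (τ∘τ⁻¹ b)) B.id⁂id) ⟩∘⟨refl)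
                   B.identityˡ))

  w : PCMor B C
  w = record
    { F₀ = w₀ ; F₁ = w₁ ; F₁-resp = w₁-resp ; F₁-id = w₁-id ; F₁-∘ = w₁-∘
    ; pres-𝟙 = w-pres-𝟙 ; pres-× = BinaryProduct.aw-IsIso
    ; Fp = wₚ ; Fp-mono = wₚ-mono ; Fp-nat = wₚ-nat ; Fp-ops = wₚ-ops
    ; Fp-Ω = wₚ-Ω ; Fp-Eq = wₚ-Eq }

  w∘k≈u : (raw w ∘ʳ raw k) ≈ʳ raw u
  w∘k≈u = record
    { obj = λ a → cong u.F₀ (k₀⁻¹∘k₀ a)
    ; hom = λ {a} {a′} f → transfer₁-coe-conjugate (k₀⁻¹∘k₀ a) (k₀⁻¹∘k₀ a′)
        (B.coe-irrelevant (sym (k₀∘k₀⁻¹ (k.F₀ a′))) (cong k.F₀ (sym (k₀⁻¹∘k₀ a′)))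
          ⟩∘⟨ (refl⟩∘⟨ B.coe-irrelevant (k₀∘k₀⁻¹ (k.F₀ a)) (cong k.F₀ (k₀⁻¹∘k₀ a))))
    ; prp = λ c x → transferₚ-coe (k₀⁻¹∘k₀ c)
        (B.Pmap-resp _ (B.coe-irrelevant (k₀∘k₀⁻¹ (k.F₀ c)) (cong k.F₀ (k₀⁻¹∘k₀ c)))) }
    where
      transfer₁-coe-conjugate : ∀ {a₁ a a₁′ a′} (e : a₁ ≡ a) (e′ : a₁′ ≡ a′)
        {g : B.Hom (k.F₀ a₁) (k.F₀ a₁′)} {f : A.Hom a a′}
        → g ≈ B.coe (cong k.F₀ (sym e′)) ∘ (k.F₁ f ∘ B.coe (cong k.F₀ e))
        → subst₂ C.Hom (cong u.F₀ e) (cong u.F₀ e′) (transfer₁ g) C.≈ u.F₁ f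
      transfer₁-coe-conjugate refl refl g≈kf =
        C.≈.trans (transfer₁-resp (B.≈.trans g≈kf (B.≈.trans B.identityˡ B.identityʳ))) (transfer₁-k₁ _)

      transferₚ-coe : ∀ {c₁ c} (e : c₁ ≡ c) {y : B.PC (k.F₀ c₁)} {x : A.PC c}
        → y ≈ₚ B.Pmap (B.coe (cong k.F₀ e)) (k.Fp c x)
        → subst C.PC (cong u.F₀ e) (transferₚ c₁ y) C.≈ₚ u.Fp c x
      transferₚ-coe refl y≈kx =
        C.≈ₚ.trans (transferₚ-resp _ (B.≈ₚ.trans y≈kx (B.Pmap-id _))) (transferₚ-kₚ _ _)

  m∘w≈v : (raw m ∘ʳ raw w) ≈ʳ raw v
  m∘w≈v = record
    { obj = mw₀≡v₀
    ; hom = λ {b} {b′} g → D.≈.trans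
        (D.subst₂-resp (mw₀≡v₀ b) (mw₀≡v₀ b′) (D.≈.sym (square.hom (k₁⁻¹ (conjugate g)))))
        (D.≈.trans
          (D.≈.reflexive (D.subst₂-subst₂ (square.obj _) (mw₀≡v₀ b) (square.obj _) (mw₀≡v₀ b′) _))
          (v.F₁-coe-conjugate _ _ (k₀∘k₀⁻¹ b) (k₀∘k₀⁻¹ b′) (k₁∘k₁⁻¹ (conjugate g))))
    ; prp = λ b y → D.≈ₚ.trans (D.subst-resp (mw₀≡v₀ b) (D.≈ₚ.sym (square.prp _ _)))
        (D.≈ₚ.trans (D.≈ₚ.reflexive (subst-subst (square.obj _) {y≡z = mw₀≡v₀ b}))
          (v.Fp-coe-conjugate _ (k₀∘k₀⁻¹ b) (kₚ∘kₚ⁻¹ _ _))) }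
    where
      mw₀≡v₀ : ∀ b → PCMor.F₀ m (w₀ b) ≡ v.F₀ b
      mw₀≡v₀ b = trans (sym (square.obj (k₀⁻¹ b))) (cong v.F₀ (k₀∘k₀⁻¹ b))

  w-unique : ∀ (w′ : PCMor B C) → (raw w′ ∘ʳ raw k) ≈ʳ raw u → (raw m ∘ʳ raw w′) ≈ʳ raw v
    → raw w′ ≈ʳ raw w
  w-unique w′ w′∘k≈u _ = record
    { obj = w′₀≡w₀
    ; hom = λ {b} {b′} g → C.≈.trans
        (w′₁-coe (k₀∘k₀⁻¹ b) (k₀∘k₀⁻¹ b′) (w′∘k≈u.obj _) (w′∘k≈u.obj _) (k₁∘k₁⁻¹ (conjugate g)))
        (w′∘k≈u.hom (k₁⁻¹ (conjugate g)))
    ; prp = λ b y → C.≈ₚ.trans (w′ₚ-coe (k₀∘k₀⁻¹ b) (w′∘k≈u.obj _) (kₚ∘kₚ⁻¹ _ _)) (w′∘k≈u.prp _ _) }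
    where
      module w′ = PCMorProperties w′
      module w′∘k≈u = _≈ʳ_ w′∘k≈u

      w′₀≡w₀ : ∀ b → w′.F₀ b ≡ w₀ b
      w′₀≡w₀ b = trans (cong w′.F₀ (sym (k₀∘k₀⁻¹ b))) (w′∘k≈u.obj (k₀⁻¹ b))

      w′₁-coe : ∀ {x b x′ b′ c c′} (e : x ≡ b) (e′ : x′ ≡ b′) (r : w′.F₀ x ≡ c) (r′ : w′.F₀ x′ ≡ c′)
        {g : B.Hom b b′} {h : B.Hom x x′} → h ≈ B.coe (sym e′) ∘ (g ∘ B.coe e)
        → subst₂ C.Hom (trans (cong w′.F₀ (sym e)) r) (trans (cong w′.F₀ (sym e′)) r′) (w′.F₁ g)
          C.≈ subst₂ C.Hom r r′ (w′.F₁ h)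
      w′₁-coe refl refl r r′ h≈g =
        C.subst₂-resp r r′ (w′.F₁-resp (B.≈.sym (B.≈.trans h≈g (B.≈.trans B.identityˡ B.identityʳ))))

      w′ₚ-coe : ∀ {x b c} (e : x ≡ b) (r : w′.F₀ x ≡ c) {y : B.PC b} {z : B.PC x}
        → z ≈ₚ B.Pmap (B.coe e) y
        → subst C.PC (trans (cong w′.F₀ (sym e)) r) (w′.Fp b y) C.≈ₚ subst C.PC r (w′.Fp x z)
      w′ₚ-coe refl r {y} z≈y = C.subst-resp r (w′.Fp-cong _ (B.≈ₚ.sym (B.≈ₚ.trans z≈y (B.Pmap-id y))))

mainTheorem13 : (𝓛 : Language) (L : Logic 𝓛) (o h e p ℓ₁ ℓ₂ : Level)
    → IsFactorizationSystem 𝓛 L o h e p ℓ₁ ℓ₂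
        (λ X Y F → IsE F)
        (λ X Y F → IsM F)
mainTheorem13 𝓛 L o h e p ℓ₁ ℓ₂ = record
  { 𝓔-iso = λ F (G , GF≈id , FG≈id) → IsE-inverse F G GF≈id FG≈id
  ; 𝓜-iso = λ F (G , GF≈id , _) → IsM-section F G GF≈id
  ; 𝓔-comp = IsE-∘
  ; 𝓜-comp = IsM-∘
  ; factor = λ {_} {Z} F → let open Image F in
      (imagePropCat , image-InFA L F (proj₂ Z)) , toImage , fromImage ,
      toImage-IsE , fromImage-IsM , image-factorization
  ; diagonal = λ k u m v k∈ℰ m∈ℳ square → let open Diagonal k u m v k∈ℰ m∈ℳ square in
      w , w∘k≈u , m∘w≈v , w-unique }
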